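{- Let $n\ge3$ and let $\mathcal M$ be an $n$-compartment mammillary model with one input, one output and no leaks, with coefficients $c_0,\dots,c_{n-1}$ as defined in the context. Let $\Sigma=\{k_{13},k_{14},\dots,k_{1n}\}$ and, for $i=0,1,\dots,n-1$, let $g_i=\sum_F\pi_F$, the sum over all spanning incoming forests $F$ of $\widetilde G$ with exactly $i$ edges. Then: (a) $c_0=0$, and for $m=1,\dots,n-1$ (with $e_0(\Sigma)=1$), $c_{n-m}=k_{21}\,e_{m-1}(\Sigma)+k_{12}\,g_{m-1}+g_m$; explicitly $c_{n-1}=k_{21}+k_{12}g_0+g_1$, $c_{n-2}=k_{21}e_1(\Sigma)+k_{12}g_1+g_2$, $\dots$, $c_1=k_{21}e_{n-2}(\Sigma)+k_{12}g_{n-2}+g_{n-1}$. (b) $\sum_{m=1}^{n-1}(-1)^{m-1}k_{12}^{\,n-1-m}c_{n-m}=\Big(\sum_{m=0}^{n-2}(-1)^m k_{12}^{\,n-2-m}e_m(\Sigma)\Big)k_{21}+k_{12}^{\,n-1}$. (c) $g_0=1$, $g_{n-1}=0$, and $(g_1,\dots,g_{n-2})^T=(e_1(\Sigma),\dots,e_{n-2}(\Sigma))^T+M\,(k_{31},k_{41},\dots,k_{n1})^T$, where $M$ is the $(n-2)\times(n-2)$ matrix whose entry in row $r$ ($1\le r\le n-2$) and column corresponding to $\ell\in\{3,\dots,n\}$ is $e_{r-1}(\Sigma\setminus\{k_{1\ell}\})$ (so the first row consists of $1$'s). (d) $\det M=\pm\prod_{3\le j<\ell\le n}(k_{1j}-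k_{1\ell})$.
   Context: A mammillary model with $n\ge3$ compartments has graph $G$ on vertices $\{1,\dots,n\}$ with edges $1\to\ell$ (parameter $k_{\ell1}$) and $\ell\to1$ (parameter $k_{1\ell}$) for $\ell=2,\dots,n$; parameters are real. With no leaks its compartmental matrix $A$ has $a_{11}=-\sum_{\ell=2}^nk_{\ell1}$, $a_{\ell\ell}=-k_{1\ell}$, $a_{1\ell}=k_{1\ell}$, $a_{\ell1}=k_{\ell1}$ for $\ell\ge2$, and all other entries $0$. The coefficients $c_k$ are defined by $\det(\lambda I-A)=\lambda^n+c_{n-1}\lambda^{n-1}+\dots+c_1\lambda+c_0$ (they are the left-hand-side coefficients of the input-output equation $y^{(n)}+c_{n-1}y^{(n-1)}+\dots+c_0y=\dots$, independent of the choice of input and output). $e_k(X)$ denotes the $k$-th elementary symmetric polynomial in the elements of a finite set $X$, with $e_0(X)=1$. $\widetilde G$ is the directed graph on $\{1,\dots,n\}$ obtained from $G$ by removing the two edges between $1$ and $2$ (edges $1\to\ell$, $\ell\to1$ for $\ell=3,\dots,n$). A spanning incoming forest of a directed graph $H$ is a subgraph containing all vertices of $H$ in which each vertex has at most one outgoing edge and whose underlying undirected multigraph has no cycles. For a subgraph $F$, $\pi_F$ is the product of the parameters labeling its edges ($\pi_F=1$ if $F$ has no edges). -}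

module Defs where

open import Level using (Level)
open import Algebra.Bundles using (CommutativeRing)
open import Data.Nat as ℕ using (ℕ; zero; suc; _∸_; _≤_; _<_; s≤s; z≤n; _≡ᵇ_; _≤ᵇ_; _<ᵇ_)
open import Data.Nat.Properties using (≤-trans)
open import Data.Fin as Fin using (Fin; toℕ; fromℕ<; punchIn)
open import Data.List as List using (List; []; _∷_; _++_; map; foldr; filterᵇ; allFin; length; concatMap; applyUpTo; upTo; zip)
open import Data.Bool using (Bool; true; false; if_then_else_; _∧_; _∨_; not)
open import Data.Product using (_×_; _,_)
open import Data.Bool.ListAction using (any; all)

module DetOps {a : Level} {A : Set a}
  (_⊕_ _⊗_ : A → A → A) (⊖_ : A → A) (zero# one# : A) where

  altSum : (m : ℕ) → (Fin m → A) → A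
  altSum zero    f = zero#
  altSum (suc m) f = f Fin.zero ⊕ (⊖ altSum m (λ j → f (Fin.suc j)))

  det : (m : ℕ) → (Fin m → Fin m → A) → A
  det zero    M = one#
  det (suc m) M =
    altSum (suc m) (λ j → M Fin.zero j ⊗ det m (λ r c → M (Fin.suc r) (punchIn j c)))

-- Vertices: compartment i (1 ≤ i ≤ n) of the paper is the element of
-- Fin n with toℕ = i - 1.

vertex₁ : ∀ {n} → 3 ≤ n → Fin n
vertex₁ p = fromℕ< (≤-trans (s≤s z≤n) p)

vertex₂ : ∀ {n} → 3 ≤ n → Fin n
vertex₂ p = fromℕ< (≤-trans (s≤s (s≤s z≤n)) p)

_==ᶠ_ : ∀ {n} → Fin n → Fin n → Bool
i ==ᶠ j = toℕ i ≡ᵇ toℕ j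

-- the compartments 3,…,n (Fin-indices with toℕ ≥ 2)
outer : (n : ℕ) → List (Fin n)
outer n = filterᵇ (λ i → 2 ≤ᵇ toℕ i) (allFin n)

outerPairs : (n : ℕ) → List (Fin n × Fin n)
outerPairs n = concatMap (λ j → map (λ l → (j , l)) (filterᵇ (λ l → toℕ j <ᵇ toℕ l) (outer n))) (outer n)

masks : ℕ → List (List Bool)
masks zero    = [] ∷ []
masks (suc k) = map (true ∷_) (masks k) ++ map (false ∷_) (masks k)

select : ∀ {b} {X : Set b} → List Bool → List X → List X
select (true ∷ bs)  (x ∷ xs) = x ∷ select bs xs
select (false ∷ bs) (x ∷ xs) = select bs xs
select _            _        = []

elemℕ : ℕ → List ℕ → Bool
elemℕ k ks = any (λ k' → k ≡ᵇ k') ks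

module Over {c ℓ} (R : CommutativeRing c ℓ) where
  open CommutativeRing R

  sumL : List Carrier → Carrier
  sumL = foldr _+_ 0#

  prodL : List Carrier → Carrier
  prodL = foldr _*_ 1#

  pow : Carrier → ℕ → Carrier
  pow x zero    = 1#
  pow x (suc k) = x * pow x k

  -- Σ_{m = lo}^{hi} f m  (empty if hi < lo)
  sumFromTo : ℕ → ℕ → (ℕ → Carrier) → Carrier
  sumFromTo lo hi f = sumL (applyUpTo (λ i → f (lo ℕ.+ i)) (suc hi ∸ lo))

  esym : ℕ → List Carrier → Carrier
  esym zero    xs       = 1#
  esym (suc k) []       = 0#
  esym (suc k) (x ∷ xs) = x * esym k xs + esym (suc k) xs

  -- Univariate polynomials over R as coefficient lists (constant term first)

  Poly : Set c
  Poly = List Carrier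

  _+ₚ_ : Poly → Poly → Poly
  []       +ₚ q        = q
  (x ∷ p)  +ₚ []       = x ∷ p
  (x ∷ p)  +ₚ (y ∷ q)  = (x + y) ∷ (p +ₚ q)

  -ₚ_ : Poly → Poly
  -ₚ p = map -_ p

  _*ₚ_ : Poly → Poly → Poly
  []      *ₚ q = []
  (x ∷ p) *ₚ q = map (x *_) q +ₚ (0# ∷ (p *ₚ q))

  constₚ : Carrier → Poly
  constₚ x = x ∷ []

  Xₚ : Poly
  Xₚ = 0# ∷ 1# ∷ []

  coeff : ℕ → Poly → Carrier
  coeff k       []      = 0#
  coeff zero    (x ∷ p) = x
  coeff (suc k) (x ∷ p) = coeff k p

  module DetR = DetOps _+_ _*_ -_ 0# 1#
  module DetP = DetOps _+ₚ_ _*ₚ_ -ₚ_ [] (1# ∷ [])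

  detR : (m : ℕ) → (Fin m → Fin m → Carrier) → Carrier
  detR = DetR.det

  detP : (m : ℕ) → (Fin m → Fin m → Poly) → Poly
  detP = DetP.det

  -- The mammillary model.  Parameters:  kin ℓ = k_{ℓ1} (edge 1 → ℓ),
  -- kout ℓ = k_{1ℓ} (edge ℓ → 1), for ℓ ≠ 1; the values at vertex 1 are unused.

  isV1 : ∀ {n} → Fin n → Bool
  isV1 i = toℕ i ≡ᵇ 0

  compMatrix : ∀ {n} → (kin kout : Fin n → Carrier) → Fin n → Fin n → Carrier
  compMatrix {n} kin kout i j =
    if isV1 i
      then (if isV1 j then - sumL (map kin (filterᵇ (λ l → not (isV1 l)) (allFin n))) else kout j)
      else (if isV1 j then kin i else (if i ==ᶠ j then - kout i else 0#))

  charPoly : ∀ {n} → (kin kout : Fin n → Carrier) → Poly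
  charPoly {n} kin kout =
    detP n (λ i j → (if i ==ᶠ j then Xₚ else []) +ₚ (-ₚ constₚ (compMatrix kin kout i j)))

  cCoeff : ∀ {n} → (kin kout : Fin n → Carrier) → ℕ → Carrier
  cCoeff kin kout k = coeff k (charPoly kin kout)

  Sigma : ∀ {n} → (kout : Fin n → Carrier) → List Carrier
  Sigma {n} kout = map kout (outer n)

  SigmaWithout : ∀ {n} → (kout : Fin n → Carrier) → Fin n → List Carrier
  SigmaWithout {n} kout l = map kout (filterᵇ (λ i → not (i ==ᶠ l)) (outer n))

  -- Directed graphs with labelled edges: list of (source , target , label).

  LEdge : ℕ → Set c
  LEdge n = Fin n × Fin n × Carrier

  Gtilde : ∀ {n} → 3 ≤ n → (kin kout : Fin n → Carrier) → List (LEdge n)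
  Gtilde {n} p kin kout =
    concatMap (λ l → (vertex₁ p , l , kin l) ∷ (l , vertex₁ p , kout l) ∷ []) (outer n)

  -- edges of a subgraph, tagged with their position in the edge list
  IEdge : ℕ → Set c
  IEdge n = ℕ × Fin n × Fin n × Carrier

  outdegAtMostOne : ∀ {n} → List (IEdge n) → Bool
  outdegAtMostOne {n} es =
    all (λ v → length (filterᵇ (λ { (_ , x , _ , _) → x ==ᶠ v }) es) ≤ᵇ 1) (allFin n)

  -- Search for a cycle of the underlying undirected multigraph through s:
  -- a closed walk s = v₀, v₁, …, v_k = s (k ≥ 1) with pairwise distinct
  -- edges and pairwise distinct v₀,…,v_{k-1}.  Current vertex v, edges
  -- used so far, vertices visited so far; fuel bounds the length.
  cycleFrom : ∀ {n} → List (IEdge n) → ℕ → Fin n → Fin n → List ℕ → List (Fin n) → Bool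
  cycleFrom {n} es zero    s v used vis = false
  cycleFrom {n} es (suc f) s v used vis = any step es
    where
    next : ℕ → Fin n → Bool
    next idx w = (w ==ᶠ s) ∨ (not (any (w ==ᶠ_) vis) ∧ cycleFrom es f s w (idx ∷ used) (w ∷ vis))
    step : IEdge _ → Bool
    step (idx , x , y , _) =
      not (elemℕ idx used) ∧ ((if x ==ᶠ v then next idx y else false) ∨ (if y ==ᶠ v then next idx x else false))

  hasUndirectedCycle : ∀ {n} → List (IEdge n) → Bool
  hasUndirectedCycle {n} es = any (λ s → cycleFrom es (length es) s s [] (s ∷ [])) (allFin n)

  -- spanning incoming forest (all vertices are always present)
  isSpanningIncomingForest : ∀ {n} → List (IEdge n) → Bool
  isSpanningIncomingForest es = outdegAtMostOne es ∧ not (hasUndirectedCycle es)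

  edgeProduct : ∀ {n} → List (IEdge n) → Carrier
  edgeProduct es = prodL (map (λ { (_ , _ , _ , κ) → κ }) es)

  forestSum : ∀ {n} → List (LEdge n) → ℕ → Carrier
  forestSum H i =
    sumL (map (λ m → let F = select m (zip (upTo (length H)) H) in
                     if isSpanningIncomingForest F ∧ (length F ≡ᵇ i) then edgeProduct F else 0#)
              (masks (length H)))

  gCoeff : ∀ {n} → 3 ≤ n → (kin kout : Fin n → Carrier) → ℕ → Carrier
  gCoeff p kin kout i = forestSum (Gtilde p kin kout) i

  -- entry of M in row r (1 ≤ r ≤ n-2) and column of compartment ℓ ∈ {3..n}
  Mentry : ∀ {n} → (kout : Fin n → Carrier) → ℕ → Fin n → Carrier
  Mentry kout r l = esym (r ∸ 1) (SigmaWithout kout l)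

  -- the (n-2)×(n-2) matrix M: row index r' ↦ r = r'+1, column index
  -- c' ↦ compartment ℓ = c' + 3 (Fin-index toℕ = c' + 2)
  Mmatrix : ∀ {n} → (kout : Fin n → Carrier) → Fin (n ∸ 2) → Fin (n ∸ 2) → Carrier
  Mmatrix {n} kout r c =
    esym (toℕ r) (map kout (filterᵇ (λ i → not (toℕ i ≡ᵇ suc (suc (toℕ c)))) (outer n)))

  vandermondeProd : ∀ {n} → (kout : Fin n → Carrier) → Carrier
  vandermondeProd {n} kout = prodL (map (λ { (j , l) → kout j - kout l }) (outerPairs n))

{-# OPTIONS --safe #-}

-- Expanding along the first row, λI - A is an arrowhead matrix with diagonal λ + Σ k_ℓ1, λ + k_12, …, λ + k_1n,
-- so c_j = e_{n-j}(k_12, …, k_1n) + Σ_ℓ k_ℓ1 e_{n-j-1}(k_12, …, k_1n without k_1ℓ).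
-- G̃ is a star around 1 with a pair of opposite edges per leaf ℓ ≥ 3, so a subgraph is a spanning incoming
-- forest iff at most one edge leaves 1 and no leaf carries both of its edges; hence
-- g_i = e_i(Σ) + Σ_ℓ k_ℓ1 e_{i-1}(Σ without k_1ℓ).  Splitting compartment 2 off the formula for c_j gives (a) and (c),
-- and (b) is the telescoping sum of (a), using g_0 = 1 and g_{n-1} = 0.  Finally M is a Vandermonde matrix in
-- disguise: subtracting its first column from the others peels off the factors k_13 - k_1ℓ.
module Submission where

open import Defs
open import Level using (Level)
open import Algebra.Bundles using (CommutativeRing)
open import Data.Nat as ℕ using (ℕ; zero; suc; _≤_; _<_; _∸_; s≤s; z≤n)
import Data.Nat.Properties as ℕP
open import Data.Fin using (Fin; zero; suc; toℕ; punchIn; punchOut; inject₁; fromℕ<)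
import Data.Fin.Properties as FinP
open import Data.List using (List; []; _∷_; _++_; map; tabulate; filterᵇ; allFin; length; concatMap; applyUpTo; zip)
open import Data.List.Relation.Unary.All as All using (All; []; _∷_)
open import Data.List.Relation.Unary.All.Properties using (++⁺; map⁺; tabulate⁺)
open import Data.List.Relation.Unary.Any using (here; there)
open import Data.List.Membership.Propositional using (_∈_)
open import Data.List.Properties using (map-tabulate; map-++; map-∘; tabulate-cong)
open import Data.Bool using (Bool; true; false; if_then_else_; not; _∧_; _∨_; T)
open import Data.Bool.Properties using (∧-zeroʳ; ∧-identityʳ; ∨-zeroʳ; not-involutive)
open import Data.Bool.ListAction using (any; all)
open import Data.Product using (_×_; _,_; proj₁; proj₂)
open import Function using (_∘_; id)
open import Function.Definitions using (Injective)
open import Data.Sum using (_⊎_; inj₁)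
open import Data.Empty using (⊥; ⊥-elim)
open import Relation.Binary.PropositionalEquality as ≡ using (_≡_; _≢_)
open import Relation.Binary.Definitions using (tri<; tri≈; tri>)
open import Relation.Nullary using (yes; no; does)
open import Relation.Nullary.Decidable using (dec-true; dec-false)

module RingFacts {c ℓ} (R : CommutativeRing c ℓ) where
  open CommutativeRing R

  +-vanishʳ : ∀ {x y} → y ≈ 0# → x + y ≈ x
  +-vanishʳ {x} y≈0 = trans (+-congˡ y≈0) (+-identityʳ x)

  +-vanishˡ : ∀ {x y} → y ≈ 0# → y + x ≈ x
  +-vanishˡ {x} y≈0 = trans (+-congʳ y≈0) (+-identityˡ x)

  *-vanishʳ : ∀ {x y} → y ≈ 0# → x * y ≈ 0#
  *-vanishʳ {x} y≈0 = trans (*-congˡ y≈0) (zeroʳ x)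

  *-vanishˡ : ∀ {x y} → y ≈ 0# → y * x ≈ 0#
  *-vanishˡ {x} y≈0 = trans (*-congʳ y≈0) (zeroˡ x)

  +-vanish : ∀ {x y} → x ≈ 0# → y ≈ 0# → x + y ≈ 0#
  +-vanish x≈0 y≈0 = trans (+-vanishʳ y≈0) x≈0

  open import Algebra.Properties.Ring ring public
    using (-0#≈0#; -‿involutive; -‿+-comm; -‿distribˡ-*; -‿distribʳ-*; -1*x≈-x)

  -‿vanish : ∀ {x} → x ≈ 0# → - x ≈ 0#
  -‿vanish x≈0 = trans (-‿cong x≈0) -0#≈0#

  -x*[-y*z]≈x*[y*z] : ∀ x y z → - x * (- y * z) ≈ x * (y * z)
  -x*[-y*z]≈x*[y*z] x y z = begin
    - x * (- y * z)      ≈⟨ *-congˡ (-‿distribˡ-* y z) ⟨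
    - x * - (y * z)      ≈⟨ -‿distribʳ-* (- x) (y * z) ⟨
    - (- x * (y * z))    ≈⟨ -‿cong (-‿distribˡ-* x (y * z)) ⟨
    - - (x * (y * z))    ≈⟨ -‿involutive _ ⟩
    x * (y * z)          ∎
    where open import Relation.Binary.Reasoning.Setoid setoid

  if-true : ∀ {b} {x y : Carrier} → b ≡ true → (if b then x else y) ≈ x
  if-true ≡.refl = refl

  if-false : ∀ {b} {x y : Carrier} → b ≡ false → (if b then x else y) ≈ y
  if-false ≡.refl = refl

T⇒≡true : ∀ {b} → T b → b ≡ true
T⇒≡true {true} _ = ≡.refl

¬T⇒≡false : ∀ {b} → (T b → ⊥) → b ≡ false
¬T⇒≡false {false} _  = ≡.refl
¬T⇒≡false {true}  ¬T = ⊥-elim (¬T _)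

all-true : ∀ {a} {A : Set a} (p : A → Bool) {xs} → All (λ x → p x ≡ true) xs → all p xs ≡ true
all-true p []                = ≡.refl
all-true p (px≡true ∷ pxs) rewrite px≡true = all-true p pxs

false≢true : false ≢ true
false≢true ()

any-false : ∀ {a} {A : Set a} {p : A → Bool} {xs} → All (λ x → p x ≡ false) xs → any p xs ≡ false
any-false []                = ≡.refl
any-false (px≡false ∷ pxs) rewrite px≡false = any-false pxs

∧-false : ∀ a b → a ∧ (b ∧ false) ≡ false
∧-false a b = ≡.trans (≡.cong (a ∧_) (∧-zeroʳ b)) (∧-zeroʳ a)

filterᵇ-tabulate-all : ∀ {a} {A : Set a} (p : A → Bool) {m} (g : Fin m → A) →
  (∀ i → p (g i) ≡ true) → filterᵇ p (tabulate g) ≡ tabulate g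
filterᵇ-tabulate-all p {zero}  g all-p = ≡.refl
filterᵇ-tabulate-all p {suc m} g all-p rewrite all-p zero =
  ≡.cong (g zero ∷_) (filterᵇ-tabulate-all p (λ i → g (suc i)) (λ i → all-p (suc i)))

applyUpTo-tabulate : ∀ {a} {A : Set a} (f : ℕ → A) m → applyUpTo f m ≡ tabulate {n = m} (f ∘ toℕ)
applyUpTo-tabulate f zero    = ≡.refl
applyUpTo-tabulate f (suc m) = ≡.cong (f 0 ∷_) (applyUpTo-tabulate (f ∘ suc) m)

filterᵇ-reject : ∀ {a} {A : Set a} (p : A → Bool) x xs → p x ≡ false → filterᵇ p (x ∷ xs) ≡ filterᵇ p xs
filterᵇ-reject p x xs px≡false rewrite px≡false = ≡.refl

filterᵇ-accept : ∀ {a} {A : Set a} (p : A → Bool) x xs → p x ≡ true → filterᵇ p (x ∷ xs) ≡ x ∷ filterᵇ p xs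
filterᵇ-accept p x xs px≡true rewrite px≡true = ≡.refl

≡ᵇ-true : ∀ {m n} → m ≡ n → (m ℕ.≡ᵇ n) ≡ true
≡ᵇ-true {m} {n} m≡n = T⇒≡true (ℕP.≡⇒≡ᵇ m n m≡n)

<ᵇ-true : ∀ {m n} → m < n → (m ℕ.<ᵇ n) ≡ true
<ᵇ-true m<n = T⇒≡true (ℕP.<⇒<ᵇ m<n)

<ᵇ-false : ∀ {m n} → n ≤ m → (m ℕ.<ᵇ n) ≡ false
<ᵇ-false {m} {n} n≤m = ¬T⇒≡false (ℕP.≤⇒≯ n≤m ∘ ℕP.<ᵇ⇒< m n)

≡ᵇ-true⁻¹ : ∀ {m n} → (m ℕ.≡ᵇ n) ≡ true → m ≡ n
≡ᵇ-true⁻¹ {m} {n} eq = ℕP.≡ᵇ⇒≡ m n (≡.subst T (≡.sym eq) _)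

≡ᵇ-false : ∀ {m n} → m ≢ n → (m ℕ.≡ᵇ n) ≡ false
≡ᵇ-false {m} {n} m≢n = ¬T⇒≡false (m≢n ∘ ℕP.≡ᵇ⇒≡ m n)

concatMap-tabulate-cong : ∀ {a b} {A : Set a} {B : Set b} {k} (g : Fin k → A) {F₁ F₂ : A → List B} →
  (∀ i → F₁ (g i) ≡ F₂ (g i)) → concatMap F₁ (tabulate g) ≡ concatMap F₂ (tabulate g)
concatMap-tabulate-cong {k = zero}  g F₁≡F₂ = ≡.refl
concatMap-tabulate-cong {k = suc k} g F₁≡F₂ = ≡.cong₂ _++_ (F₁≡F₂ zero) (concatMap-tabulate-cong (g ∘ suc) (F₁≡F₂ ∘ suc))

Consecutive : ∀ {k N} → (Fin k → Fin N) → ℕ → Set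
Consecutive g b = ∀ i → toℕ (g i) ≡ b ℕ.+ toℕ i

consecutive-tail : ∀ {k N} {g : Fin (suc k) → Fin N} {b} → Consecutive g b → Consecutive (g ∘ suc) (suc b)
consecutive-tail {b = b} consec i = ≡.trans (consec (suc i)) (ℕP.+-suc b (toℕ i))

consecutive-head : ∀ {k N} {g : Fin (suc k) → Fin N} {b} → Consecutive g b → toℕ (g zero) ≡ b
consecutive-head {b = b} consec = ≡.trans (consec zero) (ℕP.+-identityʳ b)

filterᵇ-tabulate-punchIn : ∀ {N m} (g : Fin (suc m) → Fin N) {b} → Consecutive g b → (J : Fin (suc m)) →
  filterᵇ (λ i → not (toℕ i ℕ.≡ᵇ b ℕ.+ toℕ J)) (tabulate g) ≡ tabulate (g ∘ punchIn J)
filterᵇ-tabulate-punchIn g {b} consec zero =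
  ≡.trans (filterᵇ-reject p (g zero) (tabulate (g ∘ suc)) (≡.cong not (≡ᵇ-true (consec zero))))
          (filterᵇ-tabulate-all p (g ∘ suc) (λ i → ≡.cong not (≡ᵇ-false (later≢ i))))
  where
  p = λ i → not (toℕ i ℕ.≡ᵇ b ℕ.+ 0)
  later≢ : ∀ i → toℕ (g (suc i)) ≢ b ℕ.+ 0
  later≢ i eq = ℕP.1+n≢0 (ℕP.+-cancelˡ-≡ b _ _ (≡.trans (≡.sym (consec (suc i))) eq))
filterᵇ-tabulate-punchIn {m = suc m} g {b} consec (suc J) =
  ≡.trans (filterᵇ-accept p (g zero) (tabulate (g ∘ suc)) (≡.cong not (≡ᵇ-false first≢)))
          (≡.cong (g zero ∷_) (≡.trans (≡.cong (λ v → filterᵇ (λ i → not (toℕ i ℕ.≡ᵇ v)) (tabulate (g ∘ suc))) (ℕP.+-suc b (toℕ J)))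
                                       (filterᵇ-tabulate-punchIn (g ∘ suc) (consecutive-tail consec) J)))
  where
  p = λ i → not (toℕ i ℕ.≡ᵇ b ℕ.+ suc (toℕ J))
  first≢ : toℕ (g zero) ≢ b ℕ.+ suc (toℕ J)
  first≢ eq = ℕP.0≢1+n (ℕP.+-cancelˡ-≡ b _ _ (≡.trans (≡.sym (consec zero)) eq))

+-suc-injective : ∀ {j r m} → j ℕ.+ suc r ≡ suc m → j ℕ.+ r ≡ m
+-suc-injective {j} {r} eq = ℕP.suc-injective (≡.trans (≡.sym (ℕP.+-suc j r)) eq)

toℕ-punchIn-< : ∀ {m} (i : Fin (suc m)) (k : Fin m) → toℕ k < toℕ i → toℕ (punchIn i k) ≡ toℕ k
toℕ-punchIn-< zero    k       ()
toℕ-punchIn-< (suc i) zero    _         = ≡.refl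
toℕ-punchIn-< (suc i) (suc k) (s≤s k<i) = ≡.cong suc (toℕ-punchIn-< i k k<i)

toℕ-punchIn-≥ : ∀ {m} (i : Fin (suc m)) (k : Fin m) → toℕ i ≤ toℕ k → toℕ (punchIn i k) ≡ suc (toℕ k)
toℕ-punchIn-≥ zero    k       _         = ≡.refl
toℕ-punchIn-≥ (suc i) zero    ()
toℕ-punchIn-≥ (suc i) (suc k) (s≤s i≤k) = ≡.cong suc (toℕ-punchIn-≥ i k i≤k)

punchIn-==ᶠ : ∀ {m} (i : Fin (suc m)) (k : Fin m) → (i ==ᶠ punchIn i k) ≡ false
punchIn-==ᶠ zero    k       = ≡.refl
punchIn-==ᶠ (suc i) zero    = ≡.refl
punchIn-==ᶠ (suc i) (suc k) = punchIn-==ᶠ i k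

module FiniteFamilies {c ℓ} (R : CommutativeRing c ℓ) where
  open CommutativeRing R hiding (zero)
  open Over R using (sumL; prodL; pow; esym)
  open RingFacts R
  open import Algebra.Properties.CommutativeSemigroup *-commutativeSemigroup using (x∙yz≈y∙xz)
  open import Relation.Binary.Reasoning.Setoid setoid
  open import Algebra.Solver.Ring.NaturalCoefficients.Default commutativeSemiring

  sumL-tabulate-cong : ∀ m {f g : Fin m → Carrier} → (∀ j → f j ≈ g j) → sumL (tabulate f) ≈ sumL (tabulate g)
  sumL-tabulate-cong zero    f≈g = refl
  sumL-tabulate-cong (suc m) f≈g = +-cong (f≈g zero) (sumL-tabulate-cong m (λ j → f≈g (suc j)))

  sumL-tabulate-zero : ∀ m {f : Fin m → Carrier} → (∀ j → f j ≈ 0#) → sumL (tabulate f) ≈ 0#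
  sumL-tabulate-zero zero    f≈0 = refl
  sumL-tabulate-zero (suc m) f≈0 = +-vanish (f≈0 zero) (sumL-tabulate-zero m (λ j → f≈0 (suc j)))

  sumL-tabulate-distrib-+ : ∀ m (f g : Fin m → Carrier) →
    sumL (tabulate (λ j → f j + g j)) ≈ sumL (tabulate f) + sumL (tabulate g)
  sumL-tabulate-distrib-+ zero    f g = sym (+-identityˡ 0#)
  sumL-tabulate-distrib-+ (suc m) f g =
    trans (+-congˡ (sumL-tabulate-distrib-+ m (λ j → f (suc j)) (λ j → g (suc j))))
          (solve 4 (λ a b c d → (a :+ b) :+ (c :+ d) := (a :+ c) :+ (b :+ d)) refl
                 (f zero) (g zero) (sumL (tabulate (λ j → f (suc j)))) (sumL (tabulate (λ j → g (suc j)))))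

  *-distribˡ-sumL-tabulate : ∀ m a (f : Fin m → Carrier) → a * sumL (tabulate f) ≈ sumL (tabulate (λ j → a * f j))
  *-distribˡ-sumL-tabulate zero    a f = zeroʳ a
  *-distribˡ-sumL-tabulate (suc m) a f = trans (distribˡ _ _ _) (+-congˡ (*-distribˡ-sumL-tabulate m a (λ j → f (suc j))))

  sumL-++ : ∀ xs ys → sumL (xs ++ ys) ≈ sumL xs + sumL ys
  sumL-++ []       ys = sym (+-identityˡ _)
  sumL-++ (x ∷ xs) ys = trans (+-congˡ (sumL-++ xs ys)) (sym (+-assoc _ _ _))

  sumL-map-congᴬ : ∀ {a p} {A : Set a} {P : A → Set p} {φ ψ : A → Carrier} {xs} →
    All P xs → (∀ {x} → P x → φ x ≈ ψ x) → sumL (map φ xs) ≈ sumL (map ψ xs)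
  sumL-map-congᴬ []         φ≈ψ = refl
  sumL-map-congᴬ (px ∷ pxs) φ≈ψ = +-cong (φ≈ψ px) (sumL-map-congᴬ pxs φ≈ψ)

  sumL-map-cong : ∀ {a} {A : Set a} {φ ψ : A → Carrier} xs → (∀ x → φ x ≈ ψ x) → sumL (map φ xs) ≈ sumL (map ψ xs)
  sumL-map-cong []       φ≈ψ = refl
  sumL-map-cong (x ∷ xs) φ≈ψ = +-cong (φ≈ψ x) (sumL-map-cong xs φ≈ψ)

  sumL-map-zero : ∀ {a} {A : Set a} {φ : A → Carrier} xs → (∀ x → φ x ≈ 0#) → sumL (map φ xs) ≈ 0#
  sumL-map-zero []       φ≈0 = refl
  sumL-map-zero (x ∷ xs) φ≈0 = +-vanish (φ≈0 x) (sumL-map-zero xs φ≈0)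

  sumL-map-distrib-+ : ∀ {a} {A : Set a} (φ ψ : A → Carrier) xs →
    sumL (map (λ x → φ x + ψ x) xs) ≈ sumL (map φ xs) + sumL (map ψ xs)
  sumL-map-distrib-+ φ ψ []       = sym (+-identityˡ 0#)
  sumL-map-distrib-+ φ ψ (x ∷ xs) =
    trans (+-congˡ (sumL-map-distrib-+ φ ψ xs))
          (solve 4 (λ a b c d → (a :+ b) :+ (c :+ d) := (a :+ c) :+ (b :+ d)) refl (φ x) (ψ x) (sumL (map φ xs)) (sumL (map ψ xs)))

  *-distribˡ-sumL-map : ∀ {a} {A : Set a} c (φ : A → Carrier) xs → c * sumL (map φ xs) ≈ sumL (map (λ x → c * φ x) xs)
  *-distribˡ-sumL-map c φ []       = zeroʳ c
  *-distribˡ-sumL-map c φ (x ∷ xs) = trans (distribˡ _ _ _) (+-congˡ (*-distribˡ-sumL-map c φ xs))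

  prodL-++ : ∀ xs ys → prodL (xs ++ ys) ≈ prodL xs * prodL ys
  prodL-++ []       ys = sym (*-identityˡ _)
  prodL-++ (x ∷ xs) ys = trans (*-congˡ (prodL-++ xs ys)) (sym (*-assoc _ _ _))

  alternating-telescope : ∀ M q (a : ℕ → Carrier) →
    sumL (tabulate (λ (i : Fin (suc M)) → pow (- 1#) (toℕ i) * (pow q (M ∸ toℕ i) * (q * a (toℕ i) + a (suc (toℕ i))))))
      ≈ pow q (suc M) * a 0 - pow (- 1#) (suc M) * a (suc M)
  alternating-telescope zero    q a = begin
    1# * (1# * (q * a 0 + a 1)) + 0#
      ≈⟨ solve 3 (λ q x y → con 1 :* (con 1 :* (q :* x :+ y)) :+ con 0 := (q :* con 1) :* x :+ y) refl q (a 0) (a 1) ⟩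
    (q * 1#) * a 0 + a 1
      ≈⟨ +-congˡ (trans (-‿cong (trans (*-congʳ (*-identityʳ (- 1#))) (-1*x≈-x (a 1)))) (-‿involutive (a 1))) ⟨
    (q * 1#) * a 0 - (- 1# * 1#) * a 1 ∎
  alternating-telescope (suc M) q a = begin
    1# * (Q * (q * a 0 + a 1)) + sumL (tabulate (λ (i : Fin (suc M)) → term (suc M) a (suc (toℕ i))))
      ≈⟨ +-congˡ (trans (sumL-tabulate-cong (suc M) {λ i → term (suc M) a (suc (toℕ i))} {λ i → - 1# * term M (a ∘ suc) (toℕ i)}
                                            (λ i → *-assoc (- 1#) (pow (- 1#) (toℕ i)) _))
                        (sym (*-distribˡ-sumL-tabulate (suc M) (- 1#) (λ i → term M (a ∘ suc) (toℕ i))))) ⟩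
    1# * (Q * (q * a 0 + a 1)) + - 1# * sumL (tabulate (λ (i : Fin (suc M)) → term M (a ∘ suc) (toℕ i)))
      ≈⟨ +-congˡ (*-congˡ (alternating-telescope M q (a ∘ suc))) ⟩
    1# * (Q * (q * a 0 + a 1)) + - 1# * (Q * a 1 - s * A)
      ≈⟨ +-congˡ (*-congˡ (+-congˡ (sym (-1*x≈-x (s * A))))) ⟩
    1# * (Q * (q * a 0 + a 1)) + - 1# * (Q * a 1 + - 1# * (s * A))
      ≈⟨ solve 6 (λ Q q a₀ a₁ u sA → con 1 :* (Q :* (q :* a₀ :+ a₁)) :+ u :* (Q :* a₁ :+ u :* sA)
                                     := ((q :* Q) :* a₀ :+ u :* (u :* sA)) :+ (Q :* a₁ :+ u :* (Q :* a₁))) refl Q q (a 0) (a 1) (- 1#) (s * A) ⟩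
    ((q * Q) * a 0 + - 1# * (- 1# * (s * A))) + (Q * a 1 + - 1# * (Q * a 1))
      ≈⟨ +-vanishʳ (trans (+-congˡ (-1*x≈-x _)) (-‿inverseʳ _)) ⟩
    (q * Q) * a 0 + - 1# * (- 1# * (s * A))
      ≈⟨ +-congˡ (trans (*-congˡ (sym (*-assoc (- 1#) s A))) (-1*x≈-x _)) ⟩
    (q * Q) * a 0 - (- 1# * s) * A ∎
    where
    term : ℕ → (ℕ → Carrier) → ℕ → Carrier
    term M a i = pow (- 1#) i * (pow q (M ∸ i) * (q * a i + a (suc i)))
    Q = pow q (suc M)
    s = pow (- 1#) (suc M)
    A = a (suc (suc M))

  prodL-punchIn : ∀ m (x : Fin (suc m) → Carrier) (j : Fin (suc m)) →
    prodL (tabulate x) ≈ x j * prodL (tabulate (λ i → x (punchIn j i)))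
  prodL-punchIn m       x zero    = refl
  prodL-punchIn (suc m) x (suc j) = begin
    x zero * prodL (tabulate (λ i → x (suc i)))  ≈⟨ *-congˡ (prodL-punchIn m (λ i → x (suc i)) j) ⟩
    x zero * (x (suc j) * P)                     ≈⟨ x∙yz≈y∙xz (x zero) (x (suc j)) P ⟩
    x (suc j) * (x zero * P)                     ∎
    where P = prodL (tabulate (λ i → x (suc (punchIn j i))))

  esym-tabulate-beyond : ∀ m (x : Fin m → Carrier) k → m < k → esym k (tabulate x) ≈ 0#
  esym-tabulate-beyond zero    x (suc k) _         = refl
  esym-tabulate-beyond (suc m) x (suc k) (s≤s m<k) =
    +-vanish (*-vanishʳ (esym-tabulate-beyond m (λ i → x (suc i)) k m<k))
             (esym-tabulate-beyond m (λ i → x (suc i)) (suc k) (ℕP.m<n⇒m<1+n m<k))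

  esym-punchIn : ∀ m (x : Fin (suc m) → Carrier) (j : Fin (suc m)) r →
    esym (suc r) (tabulate x) ≈ x j * esym r (tabulate (λ i → x (punchIn j i))) + esym (suc r) (tabulate (λ i → x (punchIn j i)))
  esym-punchIn m       x zero    r = refl
  esym-punchIn (suc m) x (suc j) zero = begin
    x₀ * 1# + esym 1 (tabulate x′)    ≈⟨ +-congˡ (esym-punchIn m x′ j zero) ⟩
    x₀ * 1# + (xⱼ * 1# + E₁)          ≈⟨ solve 4 (λ a b e u → a :* u :+ (b :* u :+ e) := b :* u :+ (a :* u :+ e)) refl x₀ xⱼ E₁ 1# ⟩
    xⱼ * 1# + (x₀ * 1# + E₁)          ∎
    where
    x₀ = x zero
    x′ = λ i → x (suc i)
    xⱼ = x′ j
    E₁ = esym 1 (tabulate (λ i → x′ (punchIn j i)))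
  esym-punchIn (suc m) x (suc j) (suc r) = begin
    x₀ * esym (suc r) (tabulate x′) + esym (suc (suc r)) (tabulate x′)
      ≈⟨ +-cong (*-congˡ (esym-punchIn m x′ j r)) (esym-punchIn m x′ j (suc r)) ⟩
    x₀ * (xⱼ * A + B) + (xⱼ * B + C)
      ≈⟨ solve 5 (λ a b u v w → a :* (b :* u :+ v) :+ (b :* v :+ w) := b :* (a :* u :+ v) :+ (a :* v :+ w)) refl x₀ xⱼ A B C ⟩
    xⱼ * (x₀ * A + B) + (x₀ * B + C) ∎
    where
    x₀ = x zero
    x′ = λ i → x (suc i)
    xⱼ = x′ j
    A = esym r (tabulate (λ i → x′ (punchIn j i)))
    B = esym (suc r) (tabulate (λ i → x′ (punchIn j i)))
    C = esym (suc (suc r)) (tabulate (λ i → x′ (punchIn j i)))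

module Determinants {c ℓ} (R : CommutativeRing c ℓ) where
  open CommutativeRing R hiding (zero)
  open Over R using (sumL; prodL; pow; module DetR)
  open DetR using (altSum; det)
  open RingFacts R
  open FiniteFamilies R using (prodL-punchIn)
  open import Relation.Binary.Reasoning.Setoid setoid
  open import Algebra.Solver.Ring.NaturalCoefficients.Default commutativeSemiring

  Matrix : ℕ → Set c
  Matrix m = Fin m → Fin m → Carrier

  minor : ∀ {m} → Matrix (suc m) → Fin (suc m) → Matrix m
  minor M j r k = M (suc r) (punchIn j k)

  laplaceTerm : ∀ {m} → Matrix (suc m) → Fin (suc m) → Carrier
  laplaceTerm {m} M j = M zero j * det m (minor M j)

  sign : ℕ → Carrier
  sign k = pow (- 1#) k

  altSum-cong : ∀ m {f g : Fin m → Carrier} → (∀ j → f j ≈ g j) → altSum m f ≈ altSum m g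
  altSum-cong zero    f≈g = refl
  altSum-cong (suc m) f≈g = +-cong (f≈g zero) (-‿cong (altSum-cong m (λ j → f≈g (suc j))))

  altSum-zero : ∀ m {f : Fin m → Carrier} → (∀ j → f j ≈ 0#) → altSum m f ≈ 0#
  altSum-zero zero    f≈0 = refl
  altSum-zero (suc m) f≈0 = trans (+-vanishʳ (-‿vanish (altSum-zero m (λ j → f≈0 (suc j))))) (f≈0 zero)

  altSum-head : ∀ m (f : Fin (suc m) → Carrier) → (∀ j → f (suc j) ≈ 0#) → altSum (suc m) f ≈ f zero
  altSum-head m f tail≈0 = +-vanishʳ (-‿vanish (altSum-zero m tail≈0))

  *-distribˡ-altSum : ∀ m a (f : Fin m → Carrier) → a * altSum m f ≈ altSum m (λ j → a * f j)
  *-distribˡ-altSum zero    a f = zeroʳ a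
  *-distribˡ-altSum (suc m) a f = begin
    a * (f zero - altSum m (λ j → f (suc j)))         ≈⟨ distribˡ _ _ _ ⟩
    a * f zero + a * - altSum m (λ j → f (suc j))     ≈⟨ +-congˡ (sym (-‿distribʳ-* _ _)) ⟩
    a * f zero - a * altSum m (λ j → f (suc j))       ≈⟨ +-congˡ (-‿cong (*-distribˡ-altSum m a _)) ⟩
    a * f zero - altSum m (λ j → a * f (suc j))       ∎

  altSum-distrib-+ : ∀ m (f g : Fin m → Carrier) → altSum m (λ j → f j + g j) ≈ altSum m f + altSum m g
  altSum-distrib-+ zero    f g = sym (+-identityˡ 0#)
  altSum-distrib-+ (suc m) f g = begin
    (f zero + g zero) - altSum m (λ j → f (suc j) + g (suc j))  ≈⟨ +-congˡ (-‿cong (altSum-distrib-+ m _ _)) ⟩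
    (f zero + g zero) - (F + G)                                 ≈⟨ +-congˡ (sym (-‿+-comm F G)) ⟩
    (f zero + g zero) + (- F + - G)
      ≈⟨ solve 4 (λ x y u v → (x :+ y) :+ (u :+ v) := (x :+ u) :+ (y :+ v)) refl (f zero) (g zero) (- F) (- G) ⟩
    (f zero - F) + (g zero - G)                                 ∎
    where
    F = altSum m (λ j → f (suc j))
    G = altSum m (λ j → g (suc j))

  altSum-sign : ∀ m (f : Fin m → Carrier) → altSum m (λ j → sign (toℕ j) * f j) ≈ sumL (tabulate f)
  altSum-sign zero    f = refl
  altSum-sign (suc m) f = begin
    1# * f zero - altSum m (λ j → (- 1# * sign (toℕ j)) * f (suc j))
      ≈⟨ +-cong (*-identityˡ _) (-‿cong (altSum-cong m (λ j → *-assoc _ _ _))) ⟩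
    f zero - altSum m (λ j → - 1# * (sign (toℕ j) * f (suc j)))
      ≈⟨ +-congˡ (-‿cong (sym (*-distribˡ-altSum m (- 1#) _))) ⟩
    f zero - (- 1# * altSum m (λ j → sign (toℕ j) * f (suc j)))
      ≈⟨ +-congˡ (trans (-‿cong (-1*x≈-x _)) (-‿involutive _)) ⟩
    f zero + altSum m (λ j → sign (toℕ j) * f (suc j))
      ≈⟨ +-congˡ (altSum-sign m (λ j → f (suc j))) ⟩
    sumL (tabulate f) ∎

  det-cong : ∀ m {M N : Matrix m} → (∀ r k → M r k ≈ N r k) → det m M ≈ det m N
  det-cong zero    M≈N = refl
  det-cong (suc m) M≈N =
    altSum-cong (suc m) (λ j → *-cong (M≈N zero j) (det-cong m (λ r k → M≈N (suc r) (punchIn j k))))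

  det-zeroRow : ∀ m (M : Matrix m) (i : Fin m) → (∀ k → M i k ≈ 0#) → det m M ≈ 0#
  det-zeroRow (suc m) M zero    row≈0 = altSum-zero (suc m) {laplaceTerm M} (λ j → *-vanishˡ (row≈0 j))
  det-zeroRow (suc m) M (suc i) row≈0 =
    altSum-zero (suc m) {laplaceTerm M} (λ j → *-vanishʳ (det-zeroRow m (minor M j) i (λ k → row≈0 (punchIn j k))))

  diagonal : ∀ {m} → (Fin m → Carrier) → Matrix m
  diagonal d r k = if r ==ᶠ k then d r else 0#

  det-diagonal : ∀ m (d : Fin m → Carrier) → det m (diagonal d) ≈ prodL (tabulate d)
  det-diagonal zero    d = refl
  det-diagonal (suc m) d =
    trans (altSum-head m (laplaceTerm (diagonal d)) (λ j → zeroˡ _))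
          (*-congˡ (det-diagonal m (λ i → d (suc i))))

  arrowMinor : ∀ {m} → Fin (suc m) → (c d : Fin (suc m) → Carrier) → Matrix (suc m)
  arrowMinor j c d r zero    = c r
  arrowMinor j c d r (suc k) = diagonal d r (punchIn j k)

  det-arrowMinor : ∀ m (j : Fin (suc m)) (c d : Fin (suc m) → Carrier) →
    det (suc m) (arrowMinor j c d) ≈ sign (toℕ j) * (c j * prodL (tabulate (λ i → d (punchIn j i))))
  det-arrowMinor m zero c d = begin
    det (suc m) (arrowMinor zero c d)      ≈⟨ altSum-head m (laplaceTerm (arrowMinor zero c d)) (λ j → zeroˡ _) ⟩
    c zero * det m (diagonal (λ i → d (suc i)))  ≈⟨ *-congˡ (det-diagonal m _) ⟩
    c zero * prodL (tabulate (λ i → d (suc i)))  ≈⟨ *-identityˡ _ ⟨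
    1# * (c zero * prodL (tabulate (λ i → d (suc i)))) ∎
  det-arrowMinor (suc m) (suc j) c d = begin
    altSum (suc (suc m)) (laplaceTerm Z)
      ≈⟨ +-cong (*-vanishʳ (det-zeroRow (suc m) (minor Z zero) j (λ k → if-false (punchIn-==ᶠ (suc j) k))))
                (-‿cong (altSum-head m (λ k → laplaceTerm Z (suc k)) (λ k → zeroˡ _))) ⟩
    0# - d zero * det (suc m) (minor Z (suc zero))
      ≈⟨ +-identityˡ _ ⟩
    - (d zero * det (suc m) (minor Z (suc zero)))
      ≈⟨ -‿cong (*-congˡ (det-cong (suc m) minor≈)) ⟩
    - (d zero * det (suc m) (arrowMinor j c′ d′))
      ≈⟨ -‿cong (*-congˡ (det-arrowMinor m j c′ d′)) ⟩
    - (d zero * (s * (c′ j * P)))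
      ≈⟨ -1*x≈-x _ ⟨
    - 1# * (d zero * (s * (c′ j * P)))
      ≈⟨ solve 5 (λ u a b e f → u :* (a :* (b :* (e :* f))) := (u :* b) :* (e :* (a :* f))) refl (- 1#) (d zero) s (c′ j) P ⟩
    (- 1# * s) * (c′ j * (d zero * P)) ∎
    where
    Z = arrowMinor (suc j) c d
    c′ = λ i → c (suc i)
    d′ = λ i → d (suc i)
    s = sign (toℕ j)
    P = prodL (tabulate (λ i → d′ (punchIn j i)))
    minor≈ : ∀ r k → minor Z (suc zero) r k ≈ arrowMinor j c′ d′ r k
    minor≈ r zero    = refl
    minor≈ r (suc k) = refl

  arrowhead : ∀ {m} → Carrier → (b c d : Fin m → Carrier) → Matrix (suc m)
  arrowhead a b c d zero    zero    = a
  arrowhead a b c d zero    (suc k) = b k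
  arrowhead a b c d (suc r) zero    = c r
  arrowhead a b c d (suc r) (suc k) = diagonal d r k

  det-arrowhead : ∀ m a (b c d : Fin (suc m) → Carrier) →
    det (suc (suc m)) (arrowhead a b c d) ≈
      a * prodL (tabulate d) - sumL (tabulate (λ j → b j * (c j * prodL (tabulate (λ i → d (punchIn j i))))))
  det-arrowhead m a b c d = +-cong (*-congˡ (det-diagonal (suc m) d)) (-‿cong (begin
    altSum (suc m) (λ j → b j * det (suc m) (minor A (suc j)))
      ≈⟨ altSum-cong (suc m) (λ j → *-congˡ {b j} (det-cong (suc m) (minor≈ j))) ⟩
    altSum (suc m) (λ j → b j * det (suc m) (arrowMinor j c d))
      ≈⟨ altSum-cong (suc m) (λ j → *-congˡ {b j} (det-arrowMinor m j c d)) ⟩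
    altSum (suc m) (λ j → b j * (sign (toℕ j) * X j))
      ≈⟨ altSum-cong (suc m) (λ j → solve 3 (λ u v w → u :* (v :* w) := v :* (u :* w)) refl (b j) (sign (toℕ j)) (X j)) ⟩
    altSum (suc m) (λ j → sign (toℕ j) * (b j * X j))
      ≈⟨ altSum-sign (suc m) (λ j → b j * X j) ⟩
    sumL (tabulate (λ j → b j * X j)) ∎))
    where
    A = arrowhead a b c d
    X = λ j → c j * prodL (tabulate (λ i → d (punchIn j i)))
    minor≈ : ∀ j r k → minor A (suc j) r k ≈ arrowMinor j c d r k
    minor≈ j r zero    = refl
    minor≈ j r (suc k) = refl

  det-linearInColumn : ∀ m (M M₁ M₂ : Matrix m) (c : Fin m) (a b : Carrier) →
    (∀ r k → k ≢ c → M r k ≈ M₁ r k) → (∀ r k → k ≢ c → M r k ≈ M₂ r k) →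
    (∀ r → M r c ≈ a * M₁ r c + b * M₂ r c) →
    det m M ≈ a * det m M₁ + b * det m M₂
  det-linearInColumn (suc m) M M₁ M₂ c a b M≈M₁ M≈M₂ col = begin
    altSum (suc m) (laplaceTerm M)
      ≈⟨ altSum-cong (suc m) term ⟩
    altSum (suc m) (λ j → a * laplaceTerm M₁ j + b * laplaceTerm M₂ j)
      ≈⟨ altSum-distrib-+ (suc m) (λ j → a * laplaceTerm M₁ j) (λ j → b * laplaceTerm M₂ j) ⟩
    altSum (suc m) (λ j → a * laplaceTerm M₁ j) + altSum (suc m) (λ j → b * laplaceTerm M₂ j)
      ≈⟨ +-cong (*-distribˡ-altSum (suc m) a (laplaceTerm M₁)) (*-distribˡ-altSum (suc m) b (laplaceTerm M₂)) ⟨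
    a * det (suc m) M₁ + b * det (suc m) M₂ ∎
    where
    term : ∀ j → laplaceTerm M j ≈ a * laplaceTerm M₁ j + b * laplaceTerm M₂ j
    term j with j FinP.≟ c
    ... | yes ≡.refl = begin
      M zero j * D
        ≈⟨ *-congʳ (col zero) ⟩
      (a * M₁ zero j + b * M₂ zero j) * D
        ≈⟨ solve 5 (λ a x b y z → (a :* x :+ b :* y) :* z := a :* (x :* z) :+ b :* (y :* z)) refl a (M₁ zero j) b (M₂ zero j) D ⟩
      a * (M₁ zero j * D) + b * (M₂ zero j * D)
        ≈⟨ +-cong (*-congˡ (*-congˡ (det-cong m (λ r k → M≈M₁ (suc r) (punchIn j k) (FinP.punchInᵢ≢i j k)))))
                  (*-congˡ (*-congˡ (det-cong m (λ r k → M≈M₂ (suc r) (punchIn j k) (FinP.punchInᵢ≢i j k))))) ⟩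
      a * laplaceTerm M₁ j + b * laplaceTerm M₂ j ∎
      where D = det m (minor M j)
    ... | no j≢c = begin
      M zero j * det m (minor M j)
        ≈⟨ *-congˡ (det-linearInColumn m (minor M j) (minor M₁ j) (minor M₂ j) c′ a b
             (λ r k k≢c′ → M≈M₁ (suc r) (punchIn j k) (away k k≢c′))
             (λ r k k≢c′ → M≈M₂ (suc r) (punchIn j k) (away k k≢c′))
             (λ r → ≡.subst (λ x → M (suc r) x ≈ a * M₁ (suc r) x + b * M₂ (suc r) x) (≡.sym c′↦c) (col (suc r)))) ⟩
      M zero j * (a * D₁ + b * D₂)
        ≈⟨ solve 5 (λ x a u b v → x :* (a :* u :+ b :* v) := a :* (x :* u) :+ b :* (x :* v)) refl (M zero j) a D₁ b D₂ ⟩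
      a * (M zero j * D₁) + b * (M zero j * D₂)
        ≈⟨ +-cong (*-congˡ (*-congʳ (M≈M₁ zero j j≢c))) (*-congˡ (*-congʳ (M≈M₂ zero j j≢c))) ⟩
      a * laplaceTerm M₁ j + b * laplaceTerm M₂ j ∎
      where
      c′ = punchOut j≢c
      c′↦c : punchIn j c′ ≡ c
      c′↦c = FinP.punchIn-punchOut j≢c
      away : ∀ k → k ≢ c′ → punchIn j k ≢ c
      away k k≢c′ eq = k≢c′ (FinP.punchIn-injective j k c′ (≡.trans eq (≡.sym c′↦c)))
      D₁ = det m (minor M₁ j)
      D₂ = det m (minor M₂ j)

  entry-cong : ∀ {m} (M : Matrix m) r {k k′ : Fin m} → toℕ k ≡ toℕ k′ → M r k ≈ M r k′
  entry-cong M r k≡k′ = reflexive (≡.cong (M r) (FinP.toℕ-injective k≡k′))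

  altSum-adjacentCancel : ∀ m (f : Fin (suc (suc m)) → Carrier) (c : Fin (suc m)) →
    (∀ j → toℕ j ≢ toℕ c → toℕ j ≢ suc (toℕ c) → f j ≈ 0#) →
    f (inject₁ c) ≈ f (suc c) → altSum (suc (suc m)) f ≈ 0#
  altSum-adjacentCancel m f zero away≈0 f₀≈f₁ = begin
    f zero - (f (suc zero) - altSum m (λ j → f (suc (suc j))))
      ≈⟨ +-cong f₀≈f₁ (-‿cong (+-vanishʳ (-‿vanish (altSum-zero m (λ j → away≈0 (suc (suc j)) (λ ()) (λ ())))))) ⟩
    f (suc zero) - f (suc zero)
      ≈⟨ -‿inverseʳ _ ⟩
    0# ∎
  altSum-adjacentCancel (suc m) f (suc c) away≈0 fc≈fc+1 =
    +-vanish (away≈0 zero (λ ()) (λ ()))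
    (-‿vanish (altSum-adjacentCancel m (λ j → f (suc j)) c
                (λ j ≢c ≢c+1 → away≈0 (suc j) (λ eq → ≢c (ℕP.suc-injective eq)) (λ eq → ≢c+1 (ℕP.suc-injective eq)))
                fc≈fc+1))

  det-equalAdjacentColumns : ∀ m (M : Matrix (suc (suc m))) (c : Fin (suc m)) →
    (∀ r → M r (inject₁ c) ≈ M r (suc c)) → det (suc (suc m)) M ≈ 0#
  laplaceTerm-awayFromEqualColumns : ∀ m (M : Matrix (suc (suc m))) (c : Fin (suc m)) →
    (∀ r → M r (inject₁ c) ≈ M r (suc c)) →
    ∀ j → toℕ j ≢ toℕ c → toℕ j ≢ suc (toℕ c) → laplaceTerm M j ≈ 0#

  det-equalAdjacentColumns m M c cols≈ =
    altSum-adjacentCancel m (laplaceTerm M) c (laplaceTerm-awayFromEqualColumns m M c cols≈)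
      (*-cong (cols≈ zero) (det-cong (suc m) minors≈))
    where
    ic≡c : toℕ (inject₁ c) ≡ toℕ c
    ic≡c = FinP.toℕ-inject₁ c
    minors≈ : ∀ r k → minor M (inject₁ c) r k ≈ minor M (suc c) r k
    minors≈ r k with ℕP.<-cmp (toℕ k) (toℕ c)
    ... | tri< k<c _ _ = entry-cong M (suc r)
          (≡.trans (toℕ-punchIn-< (inject₁ c) k (≡.subst (toℕ k <_) (≡.sym ic≡c) k<c))
                   (≡.sym (toℕ-punchIn-< (suc c) k (ℕP.m<n⇒m<1+n k<c))))
    ... | tri≈ _ k≡c _ = begin
          M (suc r) (punchIn (inject₁ c) k)
            ≈⟨ entry-cong M (suc r) (≡.trans (toℕ-punchIn-≥ (inject₁ c) k (ℕP.≤-reflexive (≡.trans ic≡c (≡.sym k≡c))))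
                                             (≡.cong suc k≡c)) ⟩
          M (suc r) (suc c)
            ≈⟨ cols≈ (suc r) ⟨
          M (suc r) (inject₁ c)
            ≈⟨ entry-cong M (suc r) (≡.trans ic≡c (≡.trans (≡.sym k≡c)
                                       (≡.sym (toℕ-punchIn-< (suc c) k (s≤s (ℕP.≤-reflexive k≡c)))))) ⟩
          M (suc r) (punchIn (suc c) k) ∎
    ... | tri> _ _ k>c = entry-cong M (suc r)
          (≡.trans (toℕ-punchIn-≥ (inject₁ c) k (≡.subst (_≤ toℕ k) (≡.sym ic≡c) (ℕP.<⇒≤ k>c)))
                   (≡.sym (toℕ-punchIn-≥ (suc c) k k>c)))

  laplaceTerm-awayFromEqualColumns zero M zero cols≈ zero ≢c ≢c+1 = ⊥-elim (≢c ≡.refl)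
  laplaceTerm-awayFromEqualColumns zero M zero cols≈ (suc zero) ≢c ≢c+1 = ⊥-elim (≢c+1 ≡.refl)
  laplaceTerm-awayFromEqualColumns (suc m) M c cols≈ j ≢c ≢c+1 with ℕP.<-cmp (toℕ j) (toℕ c)
  ... | tri≈ _ j≡c _ = ⊥-elim (≢c j≡c)
  laplaceTerm-awayFromEqualColumns (suc m) M (suc c) cols≈ j ≢c ≢c+1 | tri< j<c+1 _ _ =
    *-vanishʳ (det-equalAdjacentColumns m (minor M j) c (λ r → begin
      M (suc r) (punchIn j (inject₁ c))
        ≈⟨ entry-cong M (suc r) (toℕ-punchIn-≥ j (inject₁ c) (≡.subst (toℕ j ≤_) (≡.sym (FinP.toℕ-inject₁ c)) (ℕP.≤-pred j<c+1))) ⟩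
      M (suc r) (inject₁ (suc c))
        ≈⟨ cols≈ (suc r) ⟩
      M (suc r) (suc (suc c))
        ≈⟨ entry-cong M (suc r) (≡.sym (toℕ-punchIn-≥ j (suc c) (ℕP.<⇒≤ j<c+1))) ⟩
      M (suc r) (punchIn j (suc c)) ∎))
  laplaceTerm-awayFromEqualColumns (suc m) M c cols≈ j ≢c ≢c+1 | tri> _ _ j>c with ℕP.<-cmp (toℕ j) (suc (toℕ c))
  ... | tri< j<c+1 _ _ = ⊥-elim (ℕP.<-irrefl ≡.refl (ℕP.<-≤-trans j>c (ℕP.≤-pred j<c+1)))
  ... | tri≈ _ j≡c+1 _ = ⊥-elim (≢c+1 j≡c+1)
  ... | tri> _ _ j>c+1 =
    *-vanishʳ (det-equalAdjacentColumns m (minor M j) c′ (λ r → begin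
      M (suc r) (punchIn j (inject₁ c′))
        ≈⟨ entry-cong M (suc r) (≡.trans (toℕ-punchIn-< j (inject₁ c′) (≡.subst (_< toℕ j) (≡.sym c′≡c) j>c))
                                          (≡.trans c′≡c (≡.sym (FinP.toℕ-inject₁ c)))) ⟩
      M (suc r) (inject₁ c)
        ≈⟨ cols≈ (suc r) ⟩
      M (suc r) (suc c)
        ≈⟨ entry-cong M (suc r) (≡.sym (≡.trans (toℕ-punchIn-< j (suc c′) (≡.subst (λ x → suc x < toℕ j) (≡.sym (FinP.toℕ-fromℕ< c<)) j>c+1))
                                                (≡.cong suc (FinP.toℕ-fromℕ< c<)))) ⟩
      M (suc r) (punchIn j (suc c′)) ∎))
    where
    c< : toℕ c < suc m
    c< = ℕP.≤-pred (ℕP.<-≤-trans j>c+1 (ℕP.≤-pred (FinP.toℕ<n j)))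
    c′ : Fin (suc m)
    c′ = fromℕ< c<
    c′≡c : toℕ (inject₁ c′) ≡ toℕ c
    c′≡c = ≡.trans (FinP.toℕ-inject₁ c′) (FinP.toℕ-fromℕ< c<)

  replaceColumn : ∀ {m} → Matrix m → Fin m → (Fin m → Carrier) → Matrix m
  replaceColumn M s v r k = if does (k FinP.≟ s) then v r else M r k

  det-addAdjacentColumn : ∀ m (M M′ : Matrix (suc (suc m))) (c : Fin (suc m)) a →
    (∀ r k → k ≢ suc c → M′ r k ≈ M r k) →
    (∀ r → M′ r (suc c) ≈ M r (suc c) + a * M r (inject₁ c)) →
    det (suc (suc m)) M′ ≈ det (suc (suc m)) M
  det-addAdjacentColumn m M M′ c a others col = begin
    det (suc (suc m)) M′
      ≈⟨ det-linearInColumn (suc (suc m)) M′ M M₂ (suc c) 1# a others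
           (λ r k k≢ → trans (others r k k≢) (sym (replaced-other r k k≢)))
           (λ r → trans (col r) (+-cong (sym (*-identityˡ _)) (*-congˡ (sym (replaced-same r))))) ⟩
    1# * det (suc (suc m)) M + a * det (suc (suc m)) M₂
      ≈⟨ +-cong (*-identityˡ _) (*-vanishʳ (det-equalAdjacentColumns m M₂ c
           (λ r → trans (replaced-other r (inject₁ c) inject₁≢suc) (sym (replaced-same r))))) ⟩
    det (suc (suc m)) M + 0#
      ≈⟨ +-identityʳ _ ⟩
    det (suc (suc m)) M ∎
    where
    M₂ = replaceColumn M (suc c) (λ r → M r (inject₁ c))
    replaced-same : ∀ r → M₂ r (suc c) ≈ M r (inject₁ c)
    replaced-same r = if-true (dec-true (suc c FinP.≟ suc c) ≡.refl)
    replaced-other : ∀ r k → k ≢ suc c → M₂ r k ≈ M r k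
    replaced-other r k k≢ = if-false (dec-false (k FinP.≟ suc c) k≢)
    inject₁≢suc : inject₁ c ≢ suc c
    inject₁≢suc eq = ℕP.1+n≢n (≡.sym (≡.trans (≡.sym (FinP.toℕ-inject₁ c)) (≡.cong toℕ eq)))

  subtractFirstColumn : ∀ {m} → Matrix (suc m) → Matrix (suc m)
  subtractFirstColumn M r zero    = M r zero
  subtractFirstColumn M r (suc j) = M r (suc j) - M r zero

  -- Only adjacent column operations are available, so the first column is subtracted in two passes:
  -- right to left, every column becomes the difference with its left neighbour (adjacentDifferencesFrom);
  -- then left to right, these differences are telescoped back to the first column (firstDifferencesBelow).
  adjacentDifferencesFrom : ∀ {m} → ℕ → Matrix (suc m) → Matrix (suc m)
  adjacentDifferencesFrom k M r zero    = M r zero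
  adjacentDifferencesFrom k M r (suc j) = if does (k ℕ.≤? toℕ j) then M r (suc j) - M r (inject₁ j) else M r (suc j)

  firstDifferencesBelow : ∀ {m} → ℕ → Matrix (suc m) → Matrix (suc m)
  firstDifferencesBelow k M r zero    = M r zero
  firstDifferencesBelow k M r (suc j) = if does (toℕ j ℕ.<? k) then M r (suc j) - M r zero else M r (suc j) - M r (inject₁ j)

  private
    module _ {m} (M : Matrix (suc m)) (r : Fin (suc m)) where
      Δ-≥ : ∀ {k} j → k ≤ toℕ j → adjacentDifferencesFrom k M r (suc j) ≈ M r (suc j) - M r (inject₁ j)
      Δ-≥ {k} j k≤j = if-true (dec-true (k ℕ.≤? toℕ j) k≤j)

      Δ-< : ∀ {k} j → toℕ j < k → adjacentDifferencesFrom k M r (suc j) ≈ M r (suc j)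
      Δ-< {k} j j<k = if-false (dec-false (k ℕ.≤? toℕ j) (ℕP.<⇒≱ j<k))

      Φ-< : ∀ {k} j → toℕ j < k → firstDifferencesBelow k M r (suc j) ≈ M r (suc j) - M r zero
      Φ-< {k} j j<k = if-true (dec-true (toℕ j ℕ.<? k) j<k)

      Φ-≥ : ∀ {k} j → k ≤ toℕ j → firstDifferencesBelow k M r (suc j) ≈ M r (suc j) - M r (inject₁ j)
      Φ-≥ {k} j k≤j = if-false (dec-false (toℕ j ℕ.<? k) (ℕP.≤⇒≯ k≤j))

  step-invariant : (f : ℕ → Carrier) → (∀ k → f k ≈ f (suc k)) → ∀ k → f 0 ≈ f k
  step-invariant f step zero    = refl
  step-invariant f step (suc k) = trans (step-invariant f step k) (step k)

  det-adjacentDifferences-step : ∀ m (M : Matrix (suc (suc m))) k →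
    det (suc (suc m)) (adjacentDifferencesFrom k M) ≈ det (suc (suc m)) (adjacentDifferencesFrom (suc k) M)
  det-adjacentDifferences-step m M k with k ℕ.<? suc m
  ... | yes k<m+1 = det-addAdjacentColumn m (Δ (suc k)) (Δ k) j (- 1#) others column
    where
    Δ = λ k → adjacentDifferencesFrom k M
    j = fromℕ< k<m+1
    j≡k : toℕ j ≡ k
    j≡k = FinP.toℕ-fromℕ< k<m+1
    others : ∀ r i → i ≢ suc j → Δ k r i ≈ Δ (suc k) r i
    others r zero     _   = refl
    others r (suc i) i≢j with ℕP.<-cmp (toℕ i) k
    ... | tri< i<k _ _ = trans (Δ-< M r i i<k) (sym (Δ-< M r i (ℕP.m<n⇒m<1+n i<k)))
    ... | tri≈ _ i≡k _ = ⊥-elim (i≢j (≡.cong suc (FinP.toℕ-injective (≡.trans i≡k (≡.sym j≡k)))))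
    ... | tri> _ _ i>k = trans (Δ-≥ M r i (ℕP.<⇒≤ i>k)) (sym (Δ-≥ M r i i>k))
    left-unchanged : ∀ r (i : Fin (suc m)) → toℕ i ≡ k → Δ (suc k) r (inject₁ i) ≈ M r (inject₁ i)
    left-unchanged r zero    _    = refl
    left-unchanged r (suc i) i≡k  =
      Δ-< M r (inject₁ i) (ℕP.m≤n⇒m≤1+n (ℕP.≤-reflexive (≡.trans (≡.cong suc (FinP.toℕ-inject₁ i)) i≡k)))
    column : ∀ r → Δ k r (suc j) ≈ Δ (suc k) r (suc j) + - 1# * Δ (suc k) r (inject₁ j)
    column r = begin
      Δ k r (suc j)                      ≈⟨ Δ-≥ M r j (ℕP.≤-reflexive (≡.sym j≡k)) ⟩
      M r (suc j) - M r (inject₁ j)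
        ≈⟨ +-cong (Δ-< M r j (s≤s (ℕP.≤-reflexive j≡k))) (trans (-1*x≈-x _) (-‿cong (left-unchanged r j j≡k))) ⟨
      Δ (suc k) r (suc j) + - 1# * Δ (suc k) r (inject₁ j) ∎
  ... | no k≮m+1 = det-cong (suc (suc m)) unchanged
    where
    unchanged : ∀ r i → adjacentDifferencesFrom k M r i ≈ adjacentDifferencesFrom (suc k) M r i
    unchanged r zero    = refl
    unchanged r (suc i) = trans (Δ-< M r i i<k) (sym (Δ-< M r i (ℕP.m<n⇒m<1+n i<k)))
      where i<k = ℕP.<-≤-trans (FinP.toℕ<n i) (ℕP.≮⇒≥ k≮m+1)

  det-firstDifferences-step : ∀ m (M : Matrix (suc (suc m))) k →
    det (suc (suc m)) (firstDifferencesBelow (suc k) M) ≈ det (suc (suc m)) (firstDifferencesBelow k M)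
  det-firstDifferences-step m M zero = det-cong (suc (suc m)) unchanged
    where
    unchanged : ∀ r i → firstDifferencesBelow 1 M r i ≈ firstDifferencesBelow 0 M r i
    unchanged r zero          = refl
    unchanged r (suc zero)    = refl
    unchanged r (suc (suc i)) = refl
  det-firstDifferences-step m M (suc k) with suc k ℕ.<? suc m
  ... | yes k+1<m+1 = det-addAdjacentColumn m (Φ (suc k)) (Φ (suc (suc k))) j 1# others column
    where
    Φ = λ k → firstDifferencesBelow k M
    j = fromℕ< k+1<m+1
    j≡k+1 : toℕ j ≡ suc k
    j≡k+1 = FinP.toℕ-fromℕ< k+1<m+1
    others : ∀ r i → i ≢ suc j → Φ (suc (suc k)) r i ≈ Φ (suc k) r i
    others r zero     _   = refl
    others r (suc i) i≢j with ℕP.<-cmp (toℕ i) (suc k)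
    ... | tri< i<k+1 _ _ = trans (Φ-< M r i (ℕP.m<n⇒m<1+n i<k+1)) (sym (Φ-< M r i i<k+1))
    ... | tri≈ _ i≡k+1 _ = ⊥-elim (i≢j (≡.cong suc (FinP.toℕ-injective (≡.trans i≡k+1 (≡.sym j≡k+1)))))
    ... | tri> _ _ i>k+1 = trans (Φ-≥ M r i i>k+1) (sym (Φ-≥ M r i (ℕP.<⇒≤ i>k+1)))
    left-to-first : ∀ r (i : Fin (suc m)) → toℕ i ≡ suc k → Φ (suc k) r (inject₁ i) ≈ M r (inject₁ i) - M r zero
    left-to-first r (suc i) i≡k+1 =
      Φ-< M r (inject₁ i) (ℕP.≤-reflexive (≡.cong suc (≡.trans (FinP.toℕ-inject₁ i) (ℕP.suc-injective i≡k+1))))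
    telescope : ∀ x y z → (x - y) + 1# * (y - z) ≈ x - z
    telescope x y z = begin
      (x - y) + 1# * (y - z)  ≈⟨ solve 4 (λ x ny y nz → (x :+ ny) :+ con 1 :* (y :+ nz) := (x :+ nz) :+ (ny :+ y)) refl x (- y) y (- z) ⟩
      (x - z) + (- y + y)     ≈⟨ +-vanishʳ (-‿inverseˡ y) ⟩
      x - z                   ∎
    column : ∀ r → Φ (suc (suc k)) r (suc j) ≈ Φ (suc k) r (suc j) + 1# * Φ (suc k) r (inject₁ j)
    column r = begin
      Φ (suc (suc k)) r (suc j)
        ≈⟨ Φ-< M r j (s≤s (ℕP.≤-reflexive j≡k+1)) ⟩
      M r (suc j) - M r zero
        ≈⟨ telescope _ _ _ ⟨
      (M r (suc j) - M r (inject₁ j)) + 1# * (M r (inject₁ j) - M r zero)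
        ≈⟨ +-cong (Φ-≥ M r j (ℕP.≤-reflexive (≡.sym j≡k+1))) (*-congˡ (left-to-first r j j≡k+1)) ⟨
      Φ (suc k) r (suc j) + 1# * Φ (suc k) r (inject₁ j) ∎
  ... | no k+1≮m+1 = det-cong (suc (suc m)) unchanged
    where
    unchanged : ∀ r i → firstDifferencesBelow (suc (suc k)) M r i ≈ firstDifferencesBelow (suc k) M r i
    unchanged r zero    = refl
    unchanged r (suc i) = trans (Φ-< M r i (ℕP.m<n⇒m<1+n i<k+1)) (sym (Φ-< M r i i<k+1))
      where i<k+1 = ℕP.<-≤-trans (FinP.toℕ<n i) (ℕP.≮⇒≥ k+1≮m+1)

  det-subtractFirstColumn : ∀ m (M : Matrix (suc (suc m))) →
    det (suc (suc m)) M ≈ det (suc (suc m)) (subtractFirstColumn M)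
  det-subtractFirstColumn m M = begin
    det (suc (suc m)) M
      ≈⟨ det-cong (suc (suc m)) noDifferences ⟩
    det (suc (suc m)) (adjacentDifferencesFrom (suc m) M)
      ≈⟨ step-invariant (λ k → det (suc (suc m)) (adjacentDifferencesFrom k M)) (det-adjacentDifferences-step m M) (suc m) ⟨
    det (suc (suc m)) (adjacentDifferencesFrom 0 M)
      ≈⟨ det-cong (suc (suc m)) allAdjacent ⟩
    det (suc (suc m)) (firstDifferencesBelow 0 M)
      ≈⟨ step-invariant (λ k → det (suc (suc m)) (firstDifferencesBelow k M)) (λ k → sym (det-firstDifferences-step m M k)) (suc m) ⟩
    det (suc (suc m)) (firstDifferencesBelow (suc m) M)
      ≈⟨ det-cong (suc (suc m)) allFirst ⟩
    det (suc (suc m)) (subtractFirstColumn M) ∎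
    where
    noDifferences : ∀ r i → M r i ≈ adjacentDifferencesFrom (suc m) M r i
    noDifferences r zero    = refl
    noDifferences r (suc i) = sym (Δ-< M r i (FinP.toℕ<n i))
    allAdjacent : ∀ r i → adjacentDifferencesFrom 0 M r i ≈ firstDifferencesBelow 0 M r i
    allAdjacent r zero    = refl
    allAdjacent r (suc i) = refl
    allFirst : ∀ r i → firstDifferencesBelow (suc m) M r i ≈ subtractFirstColumn M r i
    allFirst r zero    = refl
    allFirst r (suc i) = Φ-< M r i (FinP.toℕ<n i)

  det-scaleColumns : ∀ m (a : Fin m → Carrier) (M : Matrix m) →
    det m (λ r k → a k * M r k) ≈ prodL (tabulate a) * det m M
  det-scaleColumns zero    a M = sym (*-identityˡ 1#)
  det-scaleColumns (suc m) a M = begin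
    altSum (suc m) (λ j → (a j * M zero j) * det m (λ r k → a (punchIn j k) * minor M j r k))
      ≈⟨ altSum-cong (suc m) (λ j → *-congˡ {a j * M zero j} (det-scaleColumns m (λ k → a (punchIn j k)) (minor M j))) ⟩
    altSum (suc m) (λ j → (a j * M zero j) * (A′ j * det m (minor M j)))
      ≈⟨ altSum-cong (suc m) (λ j → trans (solve 4 (λ a x p d → (a :* x) :* (p :* d) := (a :* p) :* (x :* d)) refl
                                                   (a j) (M zero j) (A′ j) (det m (minor M j)))
                                          (*-congʳ (sym (prodL-punchIn m a j)))) ⟩
    altSum (suc m) (λ j → prodL (tabulate a) * laplaceTerm M j)
      ≈⟨ *-distribˡ-altSum (suc m) (prodL (tabulate a)) (laplaceTerm M) ⟨
    prodL (tabulate a) * det (suc m) M ∎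
    where A′ = λ j → prodL (tabulate (λ k → a (punchIn j k)))

module Vandermonde {c ℓ} (R : CommutativeRing c ℓ) where
  open CommutativeRing R hiding (zero)
  open Over R using (prodL; esym; module DetR)
  open DetR using (det)
  open RingFacts R
  open FiniteFamilies R using (esym-punchIn; prodL-++)
  open Determinants R
  open import Relation.Binary.Reasoning.Setoid setoid
  open import Algebra.Solver.Ring.NaturalCoefficients.Default commutativeSemiring

  esymMatrix : ∀ {m} (x : Fin (suc m) → Carrier) → Matrix (suc m)
  esymMatrix x r k = esym (toℕ r) (tabulate (λ i → x (punchIn k i)))

  vandermonde : ∀ m → (Fin m → Carrier) → Carrier
  vandermonde zero    x = 1#
  vandermonde (suc m) x = prodL (tabulate (λ l → x zero - x (suc l))) * vandermonde m (λ i → x (suc i))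

  pairsProduct : ∀ {N} → (Fin N → Carrier) → List (Fin N) → List (Fin N) → Carrier
  pairsProduct x J L =
    prodL (map (λ { (j , l) → x j - x l }) (concatMap (λ j → map (λ l → (j , l)) (filterᵇ (λ l → toℕ j ℕ.<ᵇ toℕ l) L)) J))

  pairsProduct-consecutive : ∀ {N k} (x : Fin N → Carrier) (g : Fin k → Fin N) {b} → Consecutive g b →
    pairsProduct x (tabulate g) (tabulate g) ≈ vandermonde k (x ∘ g)
  pairsProduct-consecutive {k = zero}  x g consec = refl
  pairsProduct-consecutive {k = suc k} x g consec = begin
    prodL (map D (map (g₀ ,_) (filterᵇ (λ l → toℕ g₀ ℕ.<ᵇ toℕ l) (g₀ ∷ T′)) ++ concatMap (pairs (g₀ ∷ T′)) T′))
      ≡⟨ ≡.cong (λ L → prodL (map D L)) (≡.cong₂ _++_ (≡.cong (map (g₀ ,_)) first-row) (concatMap-tabulate-cong (g ∘ suc) later-rows)) ⟩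
    prodL (map D (map (g₀ ,_) T′ ++ concatMap (pairs T′) T′))
      ≡⟨ ≡.cong prodL (map-++ D (map (g₀ ,_) T′) (concatMap (pairs T′) T′)) ⟩
    prodL (map D (map (g₀ ,_) T′) ++ map D (concatMap (pairs T′) T′))
      ≈⟨ prodL-++ (map D (map (g₀ ,_) T′)) (map D (concatMap (pairs T′) T′)) ⟩
    prodL (map D (map (g₀ ,_) T′)) * pairsProduct x T′ T′
      ≈⟨ *-cong (reflexive (≡.cong prodL (≡.trans (≡.sym (map-∘ T′)) (map-tabulate (g ∘ suc) (λ l → D (g₀ , l))))))
                (pairsProduct-consecutive x (g ∘ suc) (consecutive-tail consec)) ⟩
    vandermonde (suc k) (x ∘ g) ∎
    where
    D : _ → Carrier
    D = λ { (j , l) → x j - x l }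
    g₀ = g zero
    T′ = tabulate (g ∘ suc)
    pairs = λ L j → map (λ l → (j , l)) (filterᵇ (λ l → toℕ j ℕ.<ᵇ toℕ l) L)
    g₀<later : ∀ i → toℕ g₀ < toℕ (g (suc i))
    g₀<later i = ≡.subst₂ _<_ (≡.sym (consecutive-head consec)) (≡.sym (consecutive-tail consec i)) (s≤s (ℕP.m≤m+n _ (toℕ i)))
    first-row : filterᵇ (λ l → toℕ g₀ ℕ.<ᵇ toℕ l) (g₀ ∷ T′) ≡ T′
    first-row = ≡.trans (filterᵇ-reject (λ l → toℕ g₀ ℕ.<ᵇ toℕ l) g₀ T′ (<ᵇ-false {toℕ g₀} ℕP.≤-refl))
                        (filterᵇ-tabulate-all (λ l → toℕ g₀ ℕ.<ᵇ toℕ l) (g ∘ suc) (<ᵇ-true ∘ g₀<later))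
    later-rows : ∀ i → pairs (g₀ ∷ T′) (g (suc i)) ≡ pairs T′ (g (suc i))
    later-rows i = ≡.cong (map (λ l → (g (suc i) , l)))
                          (filterᵇ-reject (λ l → toℕ (g (suc i)) ℕ.<ᵇ toℕ l) g₀ T′ (<ᵇ-false (ℕP.<⇒≤ (g₀<later i))))

  -- After subtracting the first column, the first row is (1, 0, …, 0) and column k + 1 of the
  -- minor is (x₀ - x₍ₖ₊₁₎) times column k of the same matrix for x₁, …, xₘ.
  det-esymMatrix : ∀ m (x : Fin (suc m) → Carrier) → det (suc m) (esymMatrix x) ≈ vandermonde (suc m) x
  det-esymMatrix zero    x = +-vanishʳ -0#≈0#
  det-esymMatrix (suc m) x = begin
    det (suc (suc m)) (esymMatrix x)
      ≈⟨ det-subtractFirstColumn m (esymMatrix x) ⟩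
    det (suc (suc m)) N
      ≈⟨ altSum-head (suc m) (laplaceTerm N) (λ j → *-vanishˡ (-‿inverseʳ 1#)) ⟩
    1# * det (suc m) (minor N zero)
      ≈⟨ *-identityˡ _ ⟩
    det (suc m) (minor N zero)
      ≈⟨ det-cong (suc m) minor≈ ⟩
    det (suc m) (λ r k → a k * esymMatrix x′ r k)
      ≈⟨ det-scaleColumns (suc m) a (esymMatrix x′) ⟩
    prodL (tabulate a) * det (suc m) (esymMatrix x′)
      ≈⟨ *-congˡ (det-esymMatrix m x′) ⟩
    vandermonde (suc (suc m)) x ∎
    where
    N = subtractFirstColumn (esymMatrix x)
    x′ = λ i → x (suc i)
    a = λ k → x zero - x (suc k)
    minor≈ : ∀ r k → minor N zero r k ≈ a k * esymMatrix x′ r k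
    minor≈ r k = begin
      (x zero * A + B) - esym (suc (toℕ r)) (tabulate x′)  ≈⟨ +-congˡ (-‿cong (esym-punchIn m x′ k (toℕ r))) ⟩
      (x zero * A + B) - (x′ k * A + B)                    ≈⟨ +-congˡ (-‿+-comm _ _) ⟨
      (x zero * A + B) + (- (x′ k * A) + - B)              ≈⟨ +-congˡ (+-congʳ (-‿distribˡ-* _ _)) ⟩
      (x zero * A + B) + (- x′ k * A + - B)
        ≈⟨ solve 5 (λ a A B nb nB → (a :* A :+ B) :+ (nb :* A :+ nB) := (a :+ nb) :* A :+ (B :+ nB)) refl (x zero) A B (- x′ k) (- B) ⟩
      a k * A + (B - B)                                    ≈⟨ +-vanishʳ (-‿inverseʳ B) ⟩
      a k * A                                              ∎
      where
      A = esym (toℕ r) (tabulate (λ i → x′ (punchIn k i)))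
      B = esym (suc (toℕ r)) (tabulate (λ i → x′ (punchIn k i)))

module Polynomials {c ℓ} (R : CommutativeRing c ℓ) where
  open CommutativeRing R hiding (zero)
  open Over R using (Poly; _+ₚ_; -ₚ_; _*ₚ_; coeff)
  open RingFacts R
  open import Algebra.Properties.CommutativeSemigroup +-commutativeSemigroup using (x∙yz≈y∙xz)
  open import Relation.Binary.Reasoning.Setoid setoid
  open import Algebra.Solver.Ring.NaturalCoefficients.Default commutativeSemiring

  infix 4 _≋_
  record _≋_ (p q : Poly) : Set ℓ where
    constructor mk≋
    field coeff-≈ : ∀ k → coeff k p ≈ coeff k q
  open _≋_ public

  -- coefficient k of λ·p
  coeff↑ : ℕ → Poly → Carrier
  coeff↑ zero    p = 0#
  coeff↑ (suc k) p = coeff k p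

  coeff-+ₚ : ∀ k p q → coeff k (p +ₚ q) ≈ coeff k p + coeff k q
  coeff-+ₚ k       []      q       = sym (+-identityˡ _)
  coeff-+ₚ k       (x ∷ p) []      = sym (+-identityʳ _)
  coeff-+ₚ zero    (x ∷ p) (y ∷ q) = refl
  coeff-+ₚ (suc k) (x ∷ p) (y ∷ q) = coeff-+ₚ k p q

  coeff--ₚ : ∀ k p → coeff k (-ₚ p) ≈ - coeff k p
  coeff--ₚ k       []      = sym -0#≈0#
  coeff--ₚ zero    (x ∷ p) = refl
  coeff--ₚ (suc k) (x ∷ p) = coeff--ₚ k p

  coeff-scale : ∀ k a q → coeff k (map (a *_) q) ≈ a * coeff k q
  coeff-scale k       a []      = sym (zeroʳ a)
  coeff-scale zero    a (x ∷ q) = refl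
  coeff-scale (suc k) a (x ∷ q) = coeff-scale k a q

  coeff↑-0∷ : ∀ k p → coeff k (0# ∷ p) ≈ coeff↑ k p
  coeff↑-0∷ zero    p = refl
  coeff↑-0∷ (suc k) p = refl

  coeff-∷-*ₚ : ∀ k x p q → coeff k ((x ∷ p) *ₚ q) ≈ x * coeff k q + coeff↑ k (p *ₚ q)
  coeff-∷-*ₚ k x p q = trans (coeff-+ₚ k (map (x *_) q) (0# ∷ (p *ₚ q))) (+-cong (coeff-scale k x q) (coeff↑-0∷ k (p *ₚ q)))

  coeff↑-cong : ∀ k {p q} → p ≋ q → coeff↑ k p ≈ coeff↑ k q
  coeff↑-cong zero    p≋q = refl
  coeff↑-cong (suc k) p≋q = coeff-≈ p≋q k

  coeff↑-+ₚ : ∀ k p q → coeff↑ k (p +ₚ q) ≈ coeff↑ k p + coeff↑ k q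
  coeff↑-+ₚ zero    p q = sym (+-identityˡ 0#)
  coeff↑-+ₚ (suc k) p q = coeff-+ₚ k p q

  coeff↑-scale : ∀ k a p → coeff↑ k (map (a *_) p) ≈ a * coeff↑ k p
  coeff↑-scale zero    a p = sym (zeroʳ a)
  coeff↑-scale (suc k) a p = coeff-scale k a p

  coeff↑-[] : ∀ k → coeff↑ k [] ≈ 0#
  coeff↑-[] zero    = refl
  coeff↑-[] (suc k) = refl

  ≋-refl : ∀ {p} → p ≋ p
  ≋-refl = mk≋ (λ k → refl)

  ≋-sym : ∀ {p q} → p ≋ q → q ≋ p
  ≋-sym p≋q = mk≋ (λ k → sym (coeff-≈ p≋q k))

  ≋-trans : ∀ {p q r} → p ≋ q → q ≋ r → p ≋ r
  ≋-trans p≋q q≋r = mk≋ (λ k → trans (coeff-≈ p≋q k) (coeff-≈ q≋r k))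

  ∷-cong : ∀ {x y p q} → x ≈ y → p ≋ q → (x ∷ p) ≋ (y ∷ q)
  ∷-cong x≈y p≋q = mk≋ λ { zero → x≈y ; (suc k) → coeff-≈ p≋q k }

  +ₚ-cong : ∀ {p p′ q q′} → p ≋ p′ → q ≋ q′ → (p +ₚ q) ≋ (p′ +ₚ q′)
  +ₚ-cong {p} {p′} {q} {q′} p≋p′ q≋q′ = mk≋ λ k →
    trans (coeff-+ₚ k p q) (trans (+-cong (coeff-≈ p≋p′ k) (coeff-≈ q≋q′ k)) (sym (coeff-+ₚ k p′ q′)))

  +ₚ-assoc : ∀ p q r → ((p +ₚ q) +ₚ r) ≋ (p +ₚ (q +ₚ r))
  +ₚ-assoc p q r = mk≋ λ k → begin
    coeff k ((p +ₚ q) +ₚ r)               ≈⟨ trans (coeff-+ₚ k (p +ₚ q) r) (+-congʳ (coeff-+ₚ k p q)) ⟩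
    (coeff k p + coeff k q) + coeff k r   ≈⟨ +-assoc _ _ _ ⟩
    coeff k p + (coeff k q + coeff k r)   ≈⟨ trans (coeff-+ₚ k p (q +ₚ r)) (+-congˡ (coeff-+ₚ k q r)) ⟨
    coeff k (p +ₚ (q +ₚ r))               ∎

  +ₚ-comm : ∀ p q → (p +ₚ q) ≋ (q +ₚ p)
  +ₚ-comm p q = mk≋ λ k → trans (coeff-+ₚ k p q) (trans (+-comm _ _) (sym (coeff-+ₚ k q p)))

  +ₚ-identityʳ : ∀ p → (p +ₚ []) ≋ p
  +ₚ-identityʳ p = mk≋ λ k → trans (coeff-+ₚ k p []) (+-identityʳ _)

  -ₚ-inverseˡ : ∀ p → ((-ₚ p) +ₚ p) ≋ []
  -ₚ-inverseˡ p = mk≋ λ k → trans (coeff-+ₚ k (-ₚ p) p) (trans (+-congʳ (coeff--ₚ k p)) (-‿inverseˡ _))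

  -ₚ-inverseʳ : ∀ p → (p +ₚ (-ₚ p)) ≋ []
  -ₚ-inverseʳ p = mk≋ λ k → trans (coeff-+ₚ k p (-ₚ p)) (trans (+-congˡ (coeff--ₚ k p)) (-‿inverseʳ _))

  -ₚ-cong : ∀ {p q} → p ≋ q → (-ₚ p) ≋ (-ₚ q)
  -ₚ-cong {p} {q} p≋q = mk≋ λ k → trans (coeff--ₚ k p) (trans (-‿cong (coeff-≈ p≋q k)) (sym (coeff--ₚ k q)))

  scale-cong : ∀ a {q q′} → q ≋ q′ → map (a *_) q ≋ map (a *_) q′
  scale-cong a {q} {q′} q≋q′ = mk≋ λ k → trans (coeff-scale k a q) (trans (*-congˡ (coeff-≈ q≋q′ k)) (sym (coeff-scale k a q′)))

  *ₚ-congˡ : ∀ p {q q′} → q ≋ q′ → (p *ₚ q) ≋ (p *ₚ q′)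
  *ₚ-congˡ []      q≋q′ = ≋-refl
  *ₚ-congˡ (x ∷ p) q≋q′ = +ₚ-cong (scale-cong x q≋q′) (∷-cong refl (*ₚ-congˡ p q≋q′))

  *ₚ-zeroˡ : ∀ p q → p ≋ [] → (p *ₚ q) ≋ []
  *ₚ-zeroˡ []      q p≋0 = ≋-refl
  *ₚ-zeroˡ (x ∷ p) q p≋0 = mk≋ λ k → begin
    coeff k ((x ∷ p) *ₚ q)           ≈⟨ coeff-∷-*ₚ k x p q ⟩
    x * coeff k q + coeff↑ k (p *ₚ q) ≈⟨ +-cong (*-vanishˡ (coeff-≈ p≋0 zero))
                                                 (trans (coeff↑-cong k (*ₚ-zeroˡ p q (mk≋ λ k → coeff-≈ p≋0 (suc k)))) (coeff↑-[] k)) ⟩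
    0# + 0#                          ≈⟨ +-identityˡ 0# ⟩
    0#                               ∎

  *ₚ-congʳ : ∀ {p p′} q → p ≋ p′ → (p *ₚ q) ≋ (p′ *ₚ q)
  *ₚ-congʳ {[]}    {[]}     q p≋p′ = ≋-refl
  *ₚ-congʳ {[]}    {y ∷ p′} q p≋p′ = ≋-sym (*ₚ-zeroˡ (y ∷ p′) q (≋-sym p≋p′))
  *ₚ-congʳ {x ∷ p} {[]}     q p≋p′ = *ₚ-zeroˡ (x ∷ p) q p≋p′
  *ₚ-congʳ {x ∷ p} {y ∷ p′} q p≋p′ = mk≋ λ k →
    trans (coeff-∷-*ₚ k x p q)
          (trans (+-cong (*-congʳ (coeff-≈ p≋p′ zero)) (coeff↑-cong k (*ₚ-congʳ {p} {p′} q (mk≋ λ k → coeff-≈ p≋p′ (suc k)))))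
                 (sym (coeff-∷-*ₚ k y p′ q)))

  *ₚ-cong : ∀ {p p′ q q′} → p ≋ p′ → q ≋ q′ → (p *ₚ q) ≋ (p′ *ₚ q′)
  *ₚ-cong {p} {p′} {q} p≋p′ q≋q′ = ≋-trans (*ₚ-congʳ q p≋p′) (*ₚ-congˡ p′ q≋q′)

  *ₚ-distribˡ-+ₚ : ∀ p q r → (p *ₚ (q +ₚ r)) ≋ ((p *ₚ q) +ₚ (p *ₚ r))
  *ₚ-distribˡ-+ₚ []      q r = ≋-refl
  *ₚ-distribˡ-+ₚ (x ∷ p) q r = mk≋ λ k → begin
    coeff k ((x ∷ p) *ₚ (q +ₚ r))
      ≈⟨ coeff-∷-*ₚ k x p (q +ₚ r) ⟩
    x * coeff k (q +ₚ r) + coeff↑ k (p *ₚ (q +ₚ r))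
      ≈⟨ +-cong (*-congˡ (coeff-+ₚ k q r)) (trans (coeff↑-cong k (*ₚ-distribˡ-+ₚ p q r)) (coeff↑-+ₚ k (p *ₚ q) (p *ₚ r))) ⟩
    x * (coeff k q + coeff k r) + (coeff↑ k (p *ₚ q) + coeff↑ k (p *ₚ r))
      ≈⟨ solve 5 (λ x a b u v → x :* (a :+ b) :+ (u :+ v) := (x :* a :+ u) :+ (x :* b :+ v)) refl
                 x (coeff k q) (coeff k r) (coeff↑ k (p *ₚ q)) (coeff↑ k (p *ₚ r)) ⟩
    (x * coeff k q + coeff↑ k (p *ₚ q)) + (x * coeff k r + coeff↑ k (p *ₚ r))
      ≈⟨ trans (coeff-+ₚ k ((x ∷ p) *ₚ q) ((x ∷ p) *ₚ r)) (+-cong (coeff-∷-*ₚ k x p q) (coeff-∷-*ₚ k x p r)) ⟨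
    coeff k (((x ∷ p) *ₚ q) +ₚ ((x ∷ p) *ₚ r)) ∎

  *ₚ-distribʳ-+ₚ : ∀ q p p′ → ((p +ₚ p′) *ₚ q) ≋ ((p *ₚ q) +ₚ (p′ *ₚ q))
  *ₚ-distribʳ-+ₚ q []      p′       = ≋-refl
  *ₚ-distribʳ-+ₚ q (x ∷ p) []       = ≋-sym (+ₚ-identityʳ _)
  *ₚ-distribʳ-+ₚ q (x ∷ p) (y ∷ p′) = mk≋ λ k → begin
    coeff k (((x + y) ∷ (p +ₚ p′)) *ₚ q)
      ≈⟨ coeff-∷-*ₚ k (x + y) (p +ₚ p′) q ⟩
    (x + y) * coeff k q + coeff↑ k ((p +ₚ p′) *ₚ q)
      ≈⟨ +-congˡ (trans (coeff↑-cong k (*ₚ-distribʳ-+ₚ q p p′)) (coeff↑-+ₚ k (p *ₚ q) (p′ *ₚ q))) ⟩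
    (x + y) * coeff k q + (coeff↑ k (p *ₚ q) + coeff↑ k (p′ *ₚ q))
      ≈⟨ solve 5 (λ x y a u v → (x :+ y) :* a :+ (u :+ v) := (x :* a :+ u) :+ (y :* a :+ v)) refl
                 x y (coeff k q) (coeff↑ k (p *ₚ q)) (coeff↑ k (p′ *ₚ q)) ⟩
    (x * coeff k q + coeff↑ k (p *ₚ q)) + (y * coeff k q + coeff↑ k (p′ *ₚ q))
      ≈⟨ trans (coeff-+ₚ k ((x ∷ p) *ₚ q) ((y ∷ p′) *ₚ q)) (+-cong (coeff-∷-*ₚ k x p q) (coeff-∷-*ₚ k y p′ q)) ⟨
    coeff k (((x ∷ p) *ₚ q) +ₚ ((y ∷ p′) *ₚ q)) ∎

  scale-*ₚ : ∀ x q r → ((map (x *_) q) *ₚ r) ≋ map (x *_) (q *ₚ r)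
  scale-*ₚ x []      r = ≋-refl
  scale-*ₚ x (y ∷ q) r = mk≋ λ k → begin
    coeff k (((x * y) ∷ map (x *_) q) *ₚ r)
      ≈⟨ coeff-∷-*ₚ k (x * y) (map (x *_) q) r ⟩
    (x * y) * coeff k r + coeff↑ k (map (x *_) q *ₚ r)
      ≈⟨ +-congˡ (trans (coeff↑-cong k (scale-*ₚ x q r)) (coeff↑-scale k x (q *ₚ r))) ⟩
    (x * y) * coeff k r + x * coeff↑ k (q *ₚ r)
      ≈⟨ solve 4 (λ x y a u → (x :* y) :* a :+ x :* u := x :* (y :* a :+ u)) refl x y (coeff k r) (coeff↑ k (q *ₚ r)) ⟩
    x * (y * coeff k r + coeff↑ k (q *ₚ r))
      ≈⟨ trans (coeff-scale k x ((y ∷ q) *ₚ r)) (*-congˡ (coeff-∷-*ₚ k y q r)) ⟨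
    coeff k (map (x *_) ((y ∷ q) *ₚ r)) ∎

  0∷-*ₚ : ∀ p r → ((0# ∷ p) *ₚ r) ≋ (0# ∷ (p *ₚ r))
  0∷-*ₚ p r = mk≋ λ k → trans (coeff-∷-*ₚ k 0# p r) (trans (+-vanishˡ (zeroˡ _)) (sym (coeff↑-0∷ k (p *ₚ r))))

  *ₚ-assoc : ∀ p q r → ((p *ₚ q) *ₚ r) ≋ (p *ₚ (q *ₚ r))
  *ₚ-assoc []      q r = ≋-refl
  *ₚ-assoc (x ∷ p) q r =
    ≋-trans (*ₚ-distribʳ-+ₚ r (map (x *_) q) (0# ∷ (p *ₚ q)))
            (+ₚ-cong (scale-*ₚ x q r) (≋-trans (0∷-*ₚ (p *ₚ q) r) (∷-cong refl (*ₚ-assoc p q r))))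

  *ₚ-∷ : ∀ p y q → (p *ₚ (y ∷ q)) ≋ (map (y *_) p +ₚ (0# ∷ (p *ₚ q)))
  *ₚ-∷ p y q = mk≋ (go p)
    where
    go : ∀ p k → coeff k (p *ₚ (y ∷ q)) ≈ coeff k (map (y *_) p +ₚ (0# ∷ (p *ₚ q)))
    go []      zero    = refl
    go []      (suc k) = refl
    go (x ∷ p) zero    = +-congʳ (*-comm x y)
    go (x ∷ p) (suc k) = begin
      coeff (suc k) ((x ∷ p) *ₚ (y ∷ q))
        ≈⟨ coeff-∷-*ₚ (suc k) x p (y ∷ q) ⟩
      x * coeff k q + coeff k (p *ₚ (y ∷ q))
        ≈⟨ +-congˡ (go p k) ⟩
      x * coeff k q + coeff k (map (y *_) p +ₚ (0# ∷ (p *ₚ q)))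
        ≈⟨ +-congˡ (trans (coeff-+ₚ k (map (y *_) p) (0# ∷ (p *ₚ q))) (+-cong (coeff-scale k y p) (coeff↑-0∷ k (p *ₚ q)))) ⟩
      x * coeff k q + (y * coeff k p + coeff↑ k (p *ₚ q))
        ≈⟨ x∙yz≈y∙xz (x * coeff k q) (y * coeff k p) (coeff↑ k (p *ₚ q)) ⟩
      y * coeff k p + (x * coeff k q + coeff↑ k (p *ₚ q))
        ≈⟨ trans (coeff-+ₚ (suc k) (map (y *_) (x ∷ p)) (0# ∷ ((x ∷ p) *ₚ q))) (+-cong (coeff-scale k y p) (coeff-∷-*ₚ k x p q)) ⟨
      coeff (suc k) (map (y *_) (x ∷ p) +ₚ (0# ∷ ((x ∷ p) *ₚ q))) ∎

  *ₚ-zeroʳ : ∀ p → (p *ₚ []) ≋ []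
  *ₚ-zeroʳ p = mk≋ (go p)
    where
    go : ∀ p k → coeff k (p *ₚ []) ≈ 0#
    go []      k       = refl
    go (x ∷ p) zero    = refl
    go (x ∷ p) (suc k) = go p k

  *ₚ-comm : ∀ p q → (p *ₚ q) ≋ (q *ₚ p)
  *ₚ-comm []      q = ≋-sym (*ₚ-zeroʳ q)
  *ₚ-comm (x ∷ p) q = ≋-trans (+ₚ-cong ≋-refl (∷-cong refl (*ₚ-comm p q))) (≋-sym (*ₚ-∷ q x p))

  *ₚ-identityˡ : ∀ p → ((1# ∷ []) *ₚ p) ≋ p
  *ₚ-identityˡ p = mk≋ λ k → trans (coeff-∷-*ₚ k 1# [] p) (trans (+-cong (*-identityˡ _) (coeff↑-[] k)) (+-identityʳ _))

  polynomialRing : CommutativeRing c ℓ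
  polynomialRing = record
    { Carrier = Poly
    ; _≈_ = _≋_
    ; _+_ = _+ₚ_
    ; _*_ = _*ₚ_
    ; -_ = -ₚ_
    ; 0# = []
    ; 1# = 1# ∷ []
    ; isCommutativeRing = record
      { isRing = record
        { +-isAbelianGroup = record
          { isGroup = record
            { isMonoid = record
              { isSemigroup = record
                { isMagma = record
                  { isEquivalence = record { refl = ≋-refl ; sym = ≋-sym ; trans = ≋-trans }
                  ; ∙-cong = +ₚ-cong }
                ; assoc = +ₚ-assoc }
              ; identity = (λ p → ≋-refl) , +ₚ-identityʳ }
            ; inverse = -ₚ-inverseˡ , -ₚ-inverseʳ
            ; ⁻¹-cong = -ₚ-cong }
          ; comm = +ₚ-comm }
        ; *-cong = *ₚ-cong
        ; *-assoc = *ₚ-assoc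
        ; *-identity = *ₚ-identityˡ , (λ p → ≋-trans (*ₚ-comm p (1# ∷ [])) (*ₚ-identityˡ p))
        ; distrib = *ₚ-distribˡ-+ₚ , *ₚ-distribʳ-+ₚ }
      ; *-comm = *ₚ-comm }
    }

module CharacteristicPolynomial {c ℓ} (R : CommutativeRing c ℓ) where
  open CommutativeRing R hiding (zero)
  open Over R
  open RingFacts R
  open FiniteFamilies R
  open Polynomials R
  module Pₚ = Determinants polynomialRing
  module Oₚ = Over polynomialRing
  open import Relation.Binary.Reasoning.Setoid setoid
  open import Algebra.Solver.Ring.NaturalCoefficients.Default commutativeSemiring

  coeff-constₚ-*ₚ : ∀ k a p → coeff k (constₚ a *ₚ p) ≈ a * coeff k p
  coeff-constₚ-*ₚ k a p = trans (coeff-∷-*ₚ k a [] p) (+-vanishʳ (coeff↑-[] k))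

  linear : Carrier → Poly
  linear a = Xₚ +ₚ constₚ a

  coeff₀-linear-*ₚ : ∀ a p → coeff 0 (linear a *ₚ p) ≈ a * coeff 0 p
  coeff₀-linear-*ₚ a p = trans (coeff-∷-*ₚ 0 (0# + a) (1# ∷ []) p) (trans (+-identityʳ _) (*-congʳ (+-identityˡ a)))

  coeff-suc-linear-*ₚ : ∀ k a p → coeff (suc k) (linear a *ₚ p) ≈ coeff k p + a * coeff (suc k) p
  coeff-suc-linear-*ₚ k a p = begin
    coeff (suc k) (linear a *ₚ p)                              ≈⟨ coeff-∷-*ₚ (suc k) (0# + a) (1# ∷ []) p ⟩
    (0# + a) * coeff (suc k) p + coeff k ((1# ∷ []) *ₚ p)      ≈⟨ +-cong (*-congʳ (+-identityˡ a)) (coeff-≈ (*ₚ-identityˡ p) k) ⟩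
    a * coeff (suc k) p + coeff k p                            ≈⟨ +-comm _ _ ⟩
    coeff k p + a * coeff (suc k) p                            ∎

  linearProduct : ∀ m → (Fin m → Carrier) → Poly
  linearProduct m x = Oₚ.prodL (tabulate (λ i → linear (x i)))

  coeff-linearProduct-beyond : ∀ m x j → m < j → coeff j (linearProduct m x) ≈ 0#
  coeff-linearProduct-beyond zero    x (suc j) _         = refl
  coeff-linearProduct-beyond (suc m) x (suc j) (s≤s m<j) =
    trans (coeff-suc-linear-*ₚ j (x zero) (linearProduct m x′))
          (+-vanish (coeff-linearProduct-beyond m x′ j m<j) (*-vanishʳ (coeff-linearProduct-beyond m x′ (suc j) (ℕP.m<n⇒m<1+n m<j))))
    where x′ = λ i → x (suc i)

  coeff-linearProduct : ∀ m x j r → j ℕ.+ r ≡ m → coeff j (linearProduct m x) ≈ esym r (tabulate x)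
  coeff-linearProduct zero    x zero    zero    ≡.refl = refl
  coeff-linearProduct (suc m) x zero    .(suc m) ≡.refl = begin
    coeff 0 (linear (x zero) *ₚ linearProduct m x′)  ≈⟨ coeff₀-linear-*ₚ (x zero) (linearProduct m x′) ⟩
    x zero * coeff 0 (linearProduct m x′)           ≈⟨ *-congˡ (coeff-linearProduct m x′ 0 m ≡.refl) ⟩
    x zero * esym m (tabulate x′)                   ≈⟨ +-vanishʳ (esym-tabulate-beyond m x′ (suc m) (ℕP.n<1+n m)) ⟨
    esym (suc m) (tabulate x)                       ∎
    where x′ = λ i → x (suc i)
  coeff-linearProduct (suc m) x (suc j) zero j+0≡m+1 =
    trans (coeff-suc-linear-*ₚ j (x zero) (linearProduct m x′))
          (trans (+-vanishʳ (*-vanishʳ (coeff-linearProduct-beyond m x′ (suc j) (s≤s (ℕP.≤-reflexive (≡.trans (≡.sym j+0≡m) (ℕP.+-identityʳ j)))))))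
                 (coeff-linearProduct m x′ j 0 j+0≡m))
    where
    x′ = λ i → x (suc i)
    j+0≡m = ℕP.suc-injective j+0≡m+1
  coeff-linearProduct (suc m) x (suc j) (suc r) j+r+2≡m+1 = begin
    coeff (suc j) (linear (x zero) *ₚ linearProduct m x′)
      ≈⟨ coeff-suc-linear-*ₚ j (x zero) (linearProduct m x′) ⟩
    coeff j (linearProduct m x′) + x zero * coeff (suc j) (linearProduct m x′)
      ≈⟨ +-cong (coeff-linearProduct m x′ j (suc r) j+r+1≡m)
                (*-congˡ (coeff-linearProduct m x′ (suc j) r (≡.trans (≡.sym (ℕP.+-suc j r)) j+r+1≡m))) ⟩
    esym (suc r) (tabulate x′) + x zero * esym r (tabulate x′)
      ≈⟨ +-comm _ _ ⟩
    esym (suc r) (tabulate x) ∎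
    where
    x′ = λ i → x (suc i)
    j+r+1≡m = ℕP.suc-injective j+r+2≡m+1

  coeff-sumₚ : ∀ m k (F : Fin m → Poly) → coeff k (Oₚ.sumL (tabulate F)) ≈ sumL (tabulate (λ J → coeff k (F J)))
  coeff-sumₚ zero    k F = refl
  coeff-sumₚ (suc m) k F = trans (coeff-+ₚ k (F zero) (Oₚ.sumL (tabulate (λ J → F (suc J)))))
                                 (+-congˡ (coeff-sumₚ m k (λ J → F (suc J))))

  module Star (m : ℕ) (kin kout : Fin (suc (suc m)) → Carrier) where
    kin′ kout′ : Fin (suc m) → Carrier
    kin′ i = kin (suc i)
    kout′ i = kout (suc i)

    inflow : Carrier
    inflow = sumL (tabulate kin′)

    arrowhead : Pₚ.Matrix (suc (suc m))
    arrowhead = Pₚ.arrowhead (linear inflow) (λ j → constₚ (- kout′ j)) (λ j → constₚ (- kin′ j)) (λ j → linear (kout′ j))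

    charPoly-arrowhead : charPoly kin kout ≋ detP (suc (suc m)) arrowhead
    charPoly-arrowhead = Pₚ.det-cong (suc (suc m)) entry
      where
      inflow≡ : sumL (map kin (filterᵇ (λ l → not (isV1 l)) (allFin (suc (suc m))))) ≡ inflow
      inflow≡ = ≡.cong sumL (≡.trans (≡.cong (map kin) (filterᵇ-tabulate-all (λ l → not (isV1 l)) suc (λ i → ≡.refl)))
                                     (map-tabulate suc kin))
      diagonal-entry : ∀ (b : Bool) a → ((if b then Xₚ else []) +ₚ (-ₚ constₚ (if b then - a else 0#))) ≋ (if b then linear a else [])
      diagonal-entry true  a = ∷-cong (+-congˡ (-‿involutive a)) ≋-refl
      diagonal-entry false a = mk≋ λ { zero → -0#≈0# ; (suc k) → refl }
      entry : ∀ r k → (if r ==ᶠ k then Xₚ else []) +ₚ (-ₚ constₚ (compMatrix kin kout r k)) ≋ arrowhead r k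
      entry zero    zero    = ∷-cong (+-congˡ (trans (-‿involutive _) (reflexive inflow≡))) ≋-refl
      entry zero    (suc k) = ≋-refl
      entry (suc r) zero    = ≋-refl
      entry (suc r) (suc k) = diagonal-entry (r ==ᶠ k) (kout (suc r))

    K′ : List Carrier
    K′ = tabulate kout′

    without : Fin (suc m) → Poly
    without J = linearProduct m (λ i → kout′ (punchIn J i))

    esymWithout : ℕ → Fin (suc m) → Carrier
    esymWithout r J = esym r (tabulate (λ i → kout′ (punchIn J i)))

    outflowTerm : Fin (suc m) → Poly
    outflowTerm J = constₚ (- kout′ J) *ₚ (constₚ (- kin′ J) *ₚ without J)

    charPoly-expanded : charPoly kin kout ≋ (linear inflow *ₚ linearProduct (suc m) kout′) +ₚ (-ₚ Oₚ.sumL (tabulate outflowTerm))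
    charPoly-expanded = ≋-trans charPoly-arrowhead
      (Pₚ.det-arrowhead m (linear inflow) (λ J → constₚ (- kout′ J)) (λ J → constₚ (- kin′ J)) (λ J → linear (kout′ J)))

    coeff-inflowTerm : ∀ j r → j ℕ.+ suc r ≡ suc (suc m) →
      coeff j (linear inflow *ₚ linearProduct (suc m) kout′) ≈ esym (suc r) K′ + inflow * esym r K′
    coeff-inflowTerm zero .(suc m) ≡.refl = begin
      coeff 0 (linear inflow *ₚ linearProduct (suc m) kout′)  ≈⟨ coeff₀-linear-*ₚ inflow (linearProduct (suc m) kout′) ⟩
      inflow * coeff 0 (linearProduct (suc m) kout′)         ≈⟨ *-congˡ (coeff-linearProduct (suc m) kout′ 0 (suc m) ≡.refl) ⟩
      inflow * esym (suc m) K′                               ≈⟨ +-vanishˡ (esym-tabulate-beyond (suc m) kout′ (suc (suc m)) (ℕP.n<1+n _)) ⟨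
      esym (suc (suc m)) K′ + inflow * esym (suc m) K′       ∎
    coeff-inflowTerm (suc j) r j+r+2≡m+2 = begin
      coeff (suc j) (linear inflow *ₚ linearProduct (suc m) kout′)
        ≈⟨ coeff-suc-linear-*ₚ j inflow (linearProduct (suc m) kout′) ⟩
      coeff j (linearProduct (suc m) kout′) + inflow * coeff (suc j) (linearProduct (suc m) kout′)
        ≈⟨ +-cong (coeff-linearProduct (suc m) kout′ j (suc r) j+r+1≡m+1)
                  (*-congˡ (coeff-linearProduct (suc m) kout′ (suc j) r (≡.trans (≡.sym (ℕP.+-suc j r)) j+r+1≡m+1))) ⟩
      esym (suc r) K′ + inflow * esym r K′ ∎
      where j+r+1≡m+1 = ℕP.suc-injective j+r+2≡m+2

    coeff-outflowTerms : ∀ j →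
      coeff j (Oₚ.sumL (tabulate outflowTerm)) ≈ sumL (tabulate (λ J → kout′ J * (kin′ J * coeff j (without J))))
    coeff-outflowTerms j =
      trans (coeff-sumₚ (suc m) j outflowTerm)
            (sumL-tabulate-cong (suc m) (λ J →
              trans (coeff-constₚ-*ₚ j (- kout′ J) (constₚ (- kin′ J) *ₚ without J))
                    (trans (*-congˡ { - kout′ J} (coeff-constₚ-*ₚ j (- kin′ J) (without J))) (-x*[-y*z]≈x*[y*z] _ _ _))))

    -- inflow · e_{r+1}(K′) splits along esym-punchIn; its first half cancels the outflow terms
    cancellation : ∀ j r → j ℕ.+ suc r ≡ suc (suc m) →
      (esym (suc r) K′ + inflow * esym r K′) - sumL (tabulate (λ J → kout′ J * (kin′ J * coeff j (without J))))
        ≈ esym (suc r) K′ + sumL (tabulate (λ J → kin′ J * esymWithout r J))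
    cancellation j zero j+1≡m+2 = begin
      (esym 1 K′ + inflow * 1#) - sumL (tabulate (λ J → kout′ J * (kin′ J * coeff j (without J))))
        ≈⟨ +-vanishʳ (-‿vanish (sumL-tabulate-zero (suc m) (λ J →
             *-vanishʳ {kout′ J} (*-vanishʳ {kin′ J} (coeff-linearProduct-beyond m (λ i → kout′ (punchIn J i)) j m<j))))) ⟩
      esym 1 K′ + inflow * 1#
        ≈⟨ +-congˡ (trans (*-identityʳ inflow) (sumL-tabulate-cong (suc m) {kin′} (λ J → sym (*-identityʳ _)))) ⟩
      esym 1 K′ + sumL (tabulate (λ J → kin′ J * 1#)) ∎
      where
      m<j : m < j
      m<j = ℕP.≤-reflexive (≡.trans (≡.sym (+-suc-injective j+1≡m+2)) (ℕP.+-identityʳ j))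
    cancellation j (suc r) j+r+2≡m+2 = begin
      (E + inflow * e) - sumL (tabulate (λ J → kout′ J * (kin′ J * coeff j (without J))))
        ≈⟨ +-congˡ (-‿cong (sumL-tabulate-cong (suc m) (λ J →
             *-congˡ {kout′ J} (*-congˡ {kin′ J} (coeff-linearProduct m (λ i → kout′ (punchIn J i)) j r j+r≡m))))) ⟩
      (E + inflow * e) - X
        ≈⟨ +-congʳ (+-congˡ inflow-split) ⟩
      (E + (X + Y)) - X
        ≈⟨ solve 4 (λ E X Y nX → (E :+ (X :+ Y)) :+ nX := (E :+ Y) :+ (X :+ nX)) refl E X Y (- X) ⟩
      (E + Y) + (X - X)
        ≈⟨ +-vanishʳ (-‿inverseʳ X) ⟩
      E + Y ∎
      where
      E = esym (suc (suc r)) K′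
      e = esym (suc r) K′
      X = sumL (tabulate (λ J → kout′ J * (kin′ J * esymWithout r J)))
      Y = sumL (tabulate (λ J → kin′ J * esymWithout (suc r) J))
      j+r≡m : j ℕ.+ r ≡ m
      j+r≡m = +-suc-injective (+-suc-injective j+r+2≡m+2)
      inflow-split : inflow * e ≈ X + Y
      inflow-split = begin
        inflow * e
          ≈⟨ *-comm inflow e ⟩
        e * inflow
          ≈⟨ *-distribˡ-sumL-tabulate (suc m) e kin′ ⟩
        sumL (tabulate (λ J → e * kin′ J))
          ≈⟨ sumL-tabulate-cong (suc m) (λ J → trans (*-comm _ _) (*-congˡ {kin′ J} (esym-punchIn m kout′ J r))) ⟩
        sumL (tabulate (λ J → kin′ J * (kout′ J * esymWithout r J + esymWithout (suc r) J)))
          ≈⟨ sumL-tabulate-cong (suc m) (λ J → solve 4 (λ a b x y → a :* (b :* x :+ y) := b :* (a :* x) :+ a :* y) refl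
                                                        (kin′ J) (kout′ J) (esymWithout r J) (esymWithout (suc r) J)) ⟩
        sumL (tabulate (λ J → kout′ J * (kin′ J * esymWithout r J) + kin′ J * esymWithout (suc r) J))
          ≈⟨ sumL-tabulate-distrib-+ (suc m) (λ J → kout′ J * (kin′ J * esymWithout r J)) (λ J → kin′ J * esymWithout (suc r) J) ⟩
        X + Y ∎

    coeff-charPoly : ∀ j r → j ℕ.+ suc r ≡ suc (suc m) →
      coeff j (charPoly kin kout) ≈ esym (suc r) (tabulate kout′) + sumL (tabulate (λ J → kin′ J * esymWithout r J))
    coeff-charPoly j r j+r+1≡m+2 = begin
      coeff j (charPoly kin kout)
        ≈⟨ coeff-≈ charPoly-expanded j ⟩
      coeff j ((linear inflow *ₚ linearProduct (suc m) kout′) +ₚ (-ₚ Oₚ.sumL (tabulate outflowTerm)))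
        ≈⟨ coeff-+ₚ j (linear inflow *ₚ linearProduct (suc m) kout′) (-ₚ Oₚ.sumL (tabulate outflowTerm)) ⟩
      coeff j (linear inflow *ₚ linearProduct (suc m) kout′) + coeff j (-ₚ Oₚ.sumL (tabulate outflowTerm))
        ≈⟨ +-cong (coeff-inflowTerm j r j+r+1≡m+2) (trans (coeff--ₚ j (Oₚ.sumL (tabulate outflowTerm))) (-‿cong (coeff-outflowTerms j))) ⟩
      (esym (suc r) K′ + inflow * esym r K′) - sumL (tabulate (λ J → kout′ J * (kin′ J * coeff j (without J))))
        ≈⟨ cancellation j r j+r+1≡m+2 ⟩
      esym (suc r) K′ + sumL (tabulate (λ J → kin′ J * esymWithout r J)) ∎

-- In a paired mask, the pair (a , b) of leaf ℓ selects the edge 1 → ℓ (a) and the edge ℓ → 1 (b).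
data Paired : ℕ → List Bool → Set where
  []   : Paired zero []
  pair : ∀ {k} a b {m} → Paired k m → Paired (suc k) (a ∷ b ∷ m)

double : ℕ → ℕ
double zero    = zero
double (suc k) = suc (suc (double k))

masks-paired : ∀ k → All (Paired k) (masks (double k))
masks-paired zero    = [] ∷ []
masks-paired (suc k) =
  ++⁺ (map⁺ (++⁺ (map⁺ (All.map (pair true true) IH)) (map⁺ (All.map (pair true false) IH))))
      (map⁺ (++⁺ (map⁺ (All.map (pair false true) IH)) (map⁺ (All.map (pair false false) IH))))
  where IH = masks-paired k

outdeg₁ : List Bool → ℕ
outdeg₁ (true  ∷ b ∷ m) = suc (outdeg₁ m)
outdeg₁ (false ∷ b ∷ m) = outdeg₁ m
outdeg₁ _               = 0

noTwoCycles : List Bool → Bool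
noTwoCycles (true  ∷ true  ∷ m) = false
noTwoCycles (true  ∷ false ∷ m) = noTwoCycles m
noTwoCycles (false ∷ b     ∷ m) = noTwoCycles m
noTwoCycles _                   = true

edgeCount : List Bool → ℕ
edgeCount (true  ∷ true  ∷ m) = suc (suc (edgeCount m))
edgeCount (true  ∷ false ∷ m) = suc (edgeCount m)
edgeCount (false ∷ true  ∷ m) = suc (edgeCount m)
edgeCount (false ∷ false ∷ m) = edgeCount m
edgeCount _                   = 0

module ForestSums {c ℓ} (R : CommutativeRing c ℓ) where
  open CommutativeRing R hiding (zero)
  open Over R using (sumL; esym)
  open RingFacts R
  open FiniteFamilies R
  open import Relation.Binary.Reasoning.Setoid setoid
  open import Algebra.Solver.Ring.NaturalCoefficients.Default commutativeSemiring

  -- x ℓ labels the edge ℓ → 1 and y ℓ the edge 1 → ℓ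
  maskWeight : ∀ {k} (x y : Fin k → Carrier) → List Bool → Carrier
  maskWeight {suc k} x y (true  ∷ true  ∷ m) = y zero * (x zero * maskWeight (λ i → x (suc i)) (λ i → y (suc i)) m)
  maskWeight {suc k} x y (true  ∷ false ∷ m) = y zero * maskWeight (λ i → x (suc i)) (λ i → y (suc i)) m
  maskWeight {suc k} x y (false ∷ true  ∷ m) = x zero * maskWeight (λ i → x (suc i)) (λ i → y (suc i)) m
  maskWeight {suc k} x y (false ∷ false ∷ m) = maskWeight (λ i → x (suc i)) (λ i → y (suc i)) m
  maskWeight         _ _ _                   = 1#

  forestTerm : ∀ {k} (x y : Fin k → Carrier) → ℕ → List Bool → Carrier
  forestTerm x y i m = if ((outdeg₁ m ℕ.≤ᵇ 1) ∧ noTwoCycles m) ∧ (edgeCount m ℕ.≡ᵇ i) then maskWeight x y m else 0#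

  forestTermWithOutdeg₁ : ∀ {k} → ℕ → (x y : Fin k → Carrier) → ℕ → List Bool → Carrier
  forestTermWithOutdeg₁ d x y i m =
    if (outdeg₁ m ℕ.≡ᵇ d) ∧ (noTwoCycles m ∧ (edgeCount m ℕ.≡ᵇ i)) then maskWeight x y m else 0#

  forestTerm-split : ∀ {k} (x y : Fin k → Carrier) i m →
    forestTerm x y i m ≈ forestTermWithOutdeg₁ 0 x y i m + forestTermWithOutdeg₁ 1 x y i m
  forestTerm-split x y i m with outdeg₁ m
  ... | zero          = sym (+-identityʳ _)
  ... | suc zero      = sym (+-identityˡ _)
  ... | suc (suc d)   = sym (+-identityˡ 0#)

  inflowTerm : ∀ k → (x y : Fin k → Carrier) → ℕ → Carrier
  inflowTerm zero    x y i       = 0#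
  inflowTerm (suc k) x y zero    = 0#
  inflowTerm (suc k) x y (suc i) = sumL (tabulate (λ J → esym i (tabulate (λ l → x (punchIn J l))) * y J))

  inflowTerm-zero : ∀ k x y → inflowTerm k x y zero ≈ 0#
  inflowTerm-zero zero    x y = refl
  inflowTerm-zero (suc k) x y = refl

  inflowTerm-suc : ∀ k (x y : Fin (suc k) → Carrier) i →
    let x′ = λ j → x (suc j); y′ = λ j → y (suc j) in
    y zero * esym i (tabulate x′) + (x zero * inflowTerm k x′ y′ i + inflowTerm k x′ y′ (suc i))
      ≈ inflowTerm (suc k) x y (suc i)
  inflowTerm-suc zero    x y i       = +-cong (*-comm _ _) (trans (+-vanishʳ refl) (zeroʳ _))
  inflowTerm-suc (suc k) x y zero    = +-cong (*-comm _ _) (+-vanishˡ (zeroʳ _))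
  inflowTerm-suc (suc k) x y (suc i) = +-cong (*-comm _ _) (begin
    x₀ * sumL (tabulate (λ J → A J * y′ J)) + sumL (tabulate (λ J → B J * y′ J))
      ≈⟨ +-congʳ (*-distribˡ-sumL-tabulate (suc k) x₀ (λ J → A J * y′ J)) ⟩
    sumL (tabulate (λ J → x₀ * (A J * y′ J))) + sumL (tabulate (λ J → B J * y′ J))
      ≈⟨ sumL-tabulate-distrib-+ (suc k) (λ J → x₀ * (A J * y′ J)) (λ J → B J * y′ J) ⟨
    sumL (tabulate (λ J → x₀ * (A J * y′ J) + B J * y′ J))
      ≈⟨ sumL-tabulate-cong (suc k) (λ J → solve 4 (λ x a b y → x :* (a :* y) :+ b :* y := (x :* a :+ b) :* y) refl x₀ (A J) (B J) (y′ J)) ⟩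
    sumL (tabulate (λ J → (x₀ * A J + B J) * y′ J)) ∎)
    where
    x₀ = x zero
    x′ = λ j → x (suc j)
    y′ = λ j → y (suc j)
    A = λ J → esym i (tabulate (λ l → x′ (punchIn J l)))
    B = λ J → esym (suc i) (tabulate (λ l → x′ (punchIn J l)))

  sumL-masks-double : ∀ k (φ : List Bool → Carrier) →
    let M = masks (double k) in
    sumL (map φ (masks (double (suc k)))) ≈
      (sumL (map (λ m → φ (true ∷ true ∷ m)) M) + sumL (map (λ m → φ (true ∷ false ∷ m)) M)) +
      (sumL (map (λ m → φ (false ∷ true ∷ m)) M) + sumL (map (λ m → φ (false ∷ false ∷ m)) M))
  sumL-masks-double k φ = trans (split φ (masks (suc (double k)))) (+-cong (split (λ m → φ (true ∷ m)) M) (split (λ m → φ (false ∷ m)) M))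
    where
    M = masks (double k)
    split : ∀ (ψ : List Bool → Carrier) ms → sumL (map ψ (map (true ∷_) ms ++ map (false ∷_) ms)) ≈
                                             sumL (map (λ m → ψ (true ∷ m)) ms) + sumL (map (λ m → ψ (false ∷ m)) ms)
    split ψ ms = begin
      sumL (map ψ (map (true ∷_) ms ++ map (false ∷_) ms))
        ≡⟨ ≡.cong sumL (map-++ ψ (map (true ∷_) ms) (map (false ∷_) ms)) ⟩
      sumL (map ψ (map (true ∷_) ms) ++ map ψ (map (false ∷_) ms))
        ≈⟨ sumL-++ (map ψ (map (true ∷_) ms)) (map ψ (map (false ∷_) ms)) ⟩
      sumL (map ψ (map (true ∷_) ms)) + sumL (map ψ (map (false ∷_) ms))
        ≡⟨ ≡.cong₂ (λ u v → sumL u + sumL v) (≡.sym (map-∘ ms)) (≡.sym (map-∘ ms)) ⟩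
      sumL (map (λ m → ψ (true ∷ m)) ms) + sumL (map (λ m → ψ (false ∷ m)) ms) ∎

  *-distribˡ-if : ∀ b (x w : Carrier) → (if b then x * w else 0#) ≈ x * (if b then w else 0#)
  *-distribˡ-if true  x w = refl
  *-distribˡ-if false x w = sym (zeroʳ x)

  sum-forestTermWithOutdeg₁-0 : ∀ k (x y : Fin k → Carrier) i →
    sumL (map (forestTermWithOutdeg₁ 0 x y i) (masks (double k))) ≈ esym i (tabulate x)
  sum-forestTermWithOutdeg₁-0 zero    x y zero    = +-identityʳ 1#
  sum-forestTermWithOutdeg₁-0 zero    x y (suc i) = +-identityʳ 0#
  sum-forestTermWithOutdeg₁-0 (suc k) x y i =
    trans (sumL-masks-double k (forestTermWithOutdeg₁ 0 x y i))
          (trans (+-vanishˡ (+-vanish (sumL-map-zero M (λ _ → refl)) (sumL-map-zero M (λ _ → refl)))) (leavesOnly i))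
    where
    x′ = λ j → x (suc j)
    y′ = λ j → y (suc j)
    M = masks (double k)
    leavesOnly : ∀ i → sumL (map (λ m → forestTermWithOutdeg₁ 0 x y i (false ∷ true ∷ m)) M) +
                       sumL (map (λ m → forestTermWithOutdeg₁ 0 x y i (false ∷ false ∷ m)) M) ≈ esym i (tabulate x)
    leavesOnly zero    = trans (+-vanishˡ (sumL-map-zero M (λ m → if-false (∧-false (outdeg₁ m ℕ.≡ᵇ 0) (noTwoCycles m)))))
                               (sum-forestTermWithOutdeg₁-0 k x′ y′ zero)
    leavesOnly (suc i) =
      +-cong (trans (sumL-map-cong M (λ m → *-distribˡ-if ((outdeg₁ m ℕ.≡ᵇ 0) ∧ (noTwoCycles m ∧ (edgeCount m ℕ.≡ᵇ i))) (x zero) (maskWeight x′ y′ m)))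
                    (trans (sym (*-distribˡ-sumL-map (x zero) (forestTermWithOutdeg₁ 0 x′ y′ i) M))
                           (*-congˡ (sum-forestTermWithOutdeg₁-0 k x′ y′ i))))
             (sum-forestTermWithOutdeg₁-0 k x′ y′ (suc i))

  sum-forestTermWithOutdeg₁-1 : ∀ k (x y : Fin k → Carrier) i →
    sumL (map (forestTermWithOutdeg₁ 1 x y i) (masks (double k))) ≈ inflowTerm k x y i
  sum-forestTermWithOutdeg₁-1 zero    x y i = +-identityʳ 0#
  sum-forestTermWithOutdeg₁-1 (suc k) x y i = trans (sumL-masks-double k (forestTermWithOutdeg₁ 1 x y i)) (byFirstLeaf i)
    where
    x′ = λ j → x (suc j)
    y′ = λ j → y (suc j)
    M = masks (double k)
    term = forestTermWithOutdeg₁ 1 x y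
    byFirstLeaf : ∀ i → (sumL (map (λ m → term i (true ∷ true ∷ m)) M) + sumL (map (λ m → term i (true ∷ false ∷ m)) M)) +
                        (sumL (map (λ m → term i (false ∷ true ∷ m)) M) + sumL (map (λ m → term i (false ∷ false ∷ m)) M))
                        ≈ inflowTerm (suc k) x y i
    byFirstLeaf zero = begin
      (sumL (map (λ m → term 0 (true ∷ true ∷ m)) M) + sumL (map (λ m → term 0 (true ∷ false ∷ m)) M)) +
      (sumL (map (λ m → term 0 (false ∷ true ∷ m)) M) + sumL (map (λ m → term 0 (false ∷ false ∷ m)) M))
        ≈⟨ +-cong (+-vanish (sumL-map-zero M (λ m → if-false (∧-zeroʳ (outdeg₁ m ℕ.≡ᵇ 0))))
                            (sumL-map-zero M (λ m → if-false (∧-false (outdeg₁ m ℕ.≡ᵇ 0) (noTwoCycles m)))))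
                  (+-vanishˡ (sumL-map-zero M (λ m → if-false (∧-false (outdeg₁ m ℕ.≡ᵇ 1) (noTwoCycles m))))) ⟩
      0# + sumL (map (forestTermWithOutdeg₁ 1 x′ y′ 0) M)
        ≈⟨ +-identityˡ _ ⟩
      sumL (map (forestTermWithOutdeg₁ 1 x′ y′ 0) M)
        ≈⟨ sum-forestTermWithOutdeg₁-1 k x′ y′ zero ⟩
      inflowTerm k x′ y′ 0
        ≈⟨ inflowTerm-zero k x′ y′ ⟩
      0# ∎
    byFirstLeaf (suc i) = begin
      (sumL (map (λ m → term (suc i) (true ∷ true ∷ m)) M) + sumL (map (λ m → term (suc i) (true ∷ false ∷ m)) M)) +
      (sumL (map (λ m → term (suc i) (false ∷ true ∷ m)) M) + sumL (map (λ m → term (suc i) (false ∷ false ∷ m)) M))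
        ≈⟨ +-cong (+-vanishˡ (sumL-map-zero M (λ m → if-false (∧-zeroʳ (outdeg₁ m ℕ.≡ᵇ 0)))))
                  (+-congʳ (trans (sumL-map-cong M (λ m → *-distribˡ-if (condition 1 m) (x zero) (maskWeight x′ y′ m)))
                                  (sym (*-distribˡ-sumL-map (x zero) (forestTermWithOutdeg₁ 1 x′ y′ i) M)))) ⟩
      sumL (map (λ m → term (suc i) (true ∷ false ∷ m)) M) +
      (x zero * sumL (map (forestTermWithOutdeg₁ 1 x′ y′ i) M) + sumL (map (forestTermWithOutdeg₁ 1 x′ y′ (suc i)) M))
        ≈⟨ +-cong (trans (sumL-map-cong M (λ m → *-distribˡ-if (condition 0 m) (y zero) (maskWeight x′ y′ m)))
                         (sym (*-distribˡ-sumL-map (y zero) (forestTermWithOutdeg₁ 0 x′ y′ i) M)))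
                  (+-cong (*-congˡ (sum-forestTermWithOutdeg₁-1 k x′ y′ i)) (sum-forestTermWithOutdeg₁-1 k x′ y′ (suc i))) ⟩
      y zero * sumL (map (forestTermWithOutdeg₁ 0 x′ y′ i) M) + (x zero * inflowTerm k x′ y′ i + inflowTerm k x′ y′ (suc i))
        ≈⟨ +-congʳ (*-congˡ (sum-forestTermWithOutdeg₁-0 k x′ y′ i)) ⟩
      y zero * esym i (tabulate x′) + (x zero * inflowTerm k x′ y′ i + inflowTerm k x′ y′ (suc i))
        ≈⟨ inflowTerm-suc k x y i ⟩
      inflowTerm (suc k) x y (suc i) ∎
      where
      condition : ℕ → List Bool → Bool
      condition d m = (outdeg₁ m ℕ.≡ᵇ d) ∧ (noTwoCycles m ∧ (edgeCount m ℕ.≡ᵇ i))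

  sum-forestTerm : ∀ k (x y : Fin k → Carrier) i →
    sumL (map (forestTerm x y i) (masks (double k))) ≈ esym i (tabulate x) + inflowTerm k x y i
  sum-forestTerm k x y i = begin
    sumL (map (forestTerm x y i) M)
      ≈⟨ sumL-map-cong M (forestTerm-split x y i) ⟩
    sumL (map (λ m → forestTermWithOutdeg₁ 0 x y i m + forestTermWithOutdeg₁ 1 x y i m) M)
      ≈⟨ sumL-map-distrib-+ (forestTermWithOutdeg₁ 0 x y i) (forestTermWithOutdeg₁ 1 x y i) M ⟩
    sumL (map (forestTermWithOutdeg₁ 0 x y i) M) + sumL (map (forestTermWithOutdeg₁ 1 x y i) M)
      ≈⟨ +-cong (sum-forestTermWithOutdeg₁-0 k x y i) (sum-forestTermWithOutdeg₁-1 k x y i) ⟩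
    esym i (tabulate x) + inflowTerm k x y i ∎
    where M = masks (double k)

module StarGraph {c ℓ} (R : CommutativeRing c ℓ) (n′ : ℕ) (kin kout : Fin (suc n′) → CommutativeRing.Carrier R) where
  open CommutativeRing R hiding (zero)
  open Over R
  open FiniteFamilies R using (sumL-map-congᴬ)
  open ForestSums R
  open import Relation.Binary.Reasoning.Setoid setoid

  V : Set
  V = Fin (suc n′)

  -- the centre 1 is the vertex zero
  spoke : V → List (LEdge (suc n′))
  spoke l = (zero , l , kin l) ∷ (l , zero , kout l) ∷ []

  star : ∀ {k} → (Fin k → Fin n′) → List (LEdge (suc n′))
  star h = concatMap spoke (tabulate (λ i → suc (h i)))

  length-star : ∀ {k} (h : Fin k → Fin n′) → length (star h) ≡ double k
  length-star {zero}  h = ≡.refl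
  length-star {suc k} h = ≡.cong (λ l → suc (suc l)) (length-star (h ∘ suc))

  -- the edges chosen by a mask, numbered by f (forestSum uses f = id)
  selected : ∀ {k} → (ℕ → ℕ) → (Fin k → Fin n′) → List Bool → List (IEdge (suc n′))
  selected f h m = select m (zip (applyUpTo f (length (star h))) (star h))

  outLabels inLabels : ∀ {k} → (Fin k → Fin n′) → Fin k → Carrier
  outLabels h i = kout (suc (h i))
  inLabels  h i = kin (suc (h i))

  shift₂ : (ℕ → ℕ) → ℕ → ℕ
  shift₂ f i = f (suc (suc i))

  shift₂-injective : ∀ {f} → Injective _≡_ _≡_ f → Injective _≡_ _≡_ (shift₂ f)
  shift₂-injective f-inj = ℕP.suc-injective ∘ ℕP.suc-injective ∘ f-inj

  length-selected : ∀ {k} f (h : Fin k → Fin n′) {m} → Paired k m → length (selected f h m) ≡ edgeCount m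
  length-selected f h []                  = ≡.refl
  length-selected f h (pair true  true  p) = ≡.cong (λ l → suc (suc l)) (length-selected (shift₂ f) (h ∘ suc) p)
  length-selected f h (pair true  false p) = ≡.cong suc (length-selected (shift₂ f) (h ∘ suc) p)
  length-selected f h (pair false true  p) = ≡.cong suc (length-selected (shift₂ f) (h ∘ suc) p)
  length-selected f h (pair false false p) = length-selected (shift₂ f) (h ∘ suc) p

  edgeProduct-selected : ∀ {k} f (h : Fin k → Fin n′) {m} → Paired k m →
    edgeProduct (selected f h m) ≡ maskWeight (outLabels h) (inLabels h) m
  edgeProduct-selected f h []                  = ≡.refl
  edgeProduct-selected f h (pair true  true  p) =
    ≡.cong (λ w → inLabels h zero * (outLabels h zero * w)) (edgeProduct-selected (shift₂ f) (h ∘ suc) p)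
  edgeProduct-selected f h (pair true  false p) = ≡.cong (inLabels h zero *_) (edgeProduct-selected (shift₂ f) (h ∘ suc) p)
  edgeProduct-selected f h (pair false true  p) = ≡.cong (outLabels h zero *_) (edgeProduct-selected (shift₂ f) (h ∘ suc) p)
  edgeProduct-selected f h (pair false false p) = edgeProduct-selected (shift₂ f) (h ∘ suc) p

  hasSource : V → IEdge (suc n′) → Bool
  hasSource v (_ , x , _ , _) = x ==ᶠ v

  outdeg : V → List (IEdge (suc n′)) → ℕ
  outdeg v F = length (filterᵇ (hasSource v) F)

  outdeg-centre : ∀ {k} f (h : Fin k → Fin n′) {m} → Paired k m → outdeg zero (selected f h m) ≡ outdeg₁ m
  outdeg-centre f h []                  = ≡.refl
  outdeg-centre f h (pair true  true  p) = ≡.cong suc (outdeg-centre (shift₂ f) (h ∘ suc) p)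
  outdeg-centre f h (pair true  false p) = ≡.cong suc (outdeg-centre (shift₂ f) (h ∘ suc) p)
  outdeg-centre f h (pair false true  p) = outdeg-centre (shift₂ f) (h ∘ suc) p
  outdeg-centre f h (pair false false p) = outdeg-centre (shift₂ f) (h ∘ suc) p

  outdeg-leaf : ∀ {k} f (h : Fin k → Fin n′) {b} → Consecutive h b → ∀ {m} → Paired k m → ∀ (v : Fin n′) →
    (toℕ v < b → outdeg (suc v) (selected f h m) ≡ 0) × outdeg (suc v) (selected f h m) ≤ 1
  outdeg-leaf f h consec []               v = (λ _ → ≡.refl) , z≤n
  outdeg-leaf f h consec (pair a false p) v with outdeg-leaf (shift₂ f) (h ∘ suc) (consecutive-tail consec) p v
  outdeg-leaf f h consec (pair true  false p) v | none-before , atMostOne = (λ v<b → none-before (ℕP.m<n⇒m<1+n v<b)) , atMostOne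
  outdeg-leaf f h consec (pair false false p) v | none-before , atMostOne = (λ v<b → none-before (ℕP.m<n⇒m<1+n v<b)) , atMostOne
  outdeg-leaf f h {b} consec (pair a true {m} p) v = outdeg-withReturn a
    where
    IH = outdeg-leaf (shift₂ f) (h ∘ suc) (consecutive-tail consec) p v
    F′ = selected (shift₂ f) (h ∘ suc) m
    return : IEdge (suc n′)
    return = (f 1 , suc (h zero) , zero , kout (suc (h zero)))
    withReturn : (toℕ v < b → length (filterᵇ (hasSource (suc v)) (return ∷ F′)) ≡ 0) ×
                 length (filterᵇ (hasSource (suc v)) (return ∷ F′)) ≤ 1
    withReturn with toℕ (h zero) ℕ.≡ᵇ toℕ v in eq
    ... | true  = (λ v<b → ⊥-elim (ℕP.<-irrefl (≡.trans (≡.sym v≡h₀) (consecutive-head consec)) v<b)) ,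
                  s≤s (ℕP.≤-reflexive (proj₁ IH (s≤s (ℕP.≤-reflexive (≡.trans (≡.sym v≡h₀) (consecutive-head consec))))))
      where v≡h₀ = ≡ᵇ-true⁻¹ eq
    ... | false = (λ v<b → proj₁ IH (ℕP.m<n⇒m<1+n v<b)) , proj₂ IH
    outdeg-withReturn : ∀ a → (toℕ v < b → outdeg (suc v) (selected f h (a ∷ true ∷ m)) ≡ 0) ×
                              outdeg (suc v) (selected f h (a ∷ true ∷ m)) ≤ 1
    outdeg-withReturn true  = withReturn
    outdeg-withReturn false = withReturn

  outdegAtMostOne-selected : ∀ {k} f (h : Fin k → Fin n′) {b} → Consecutive h b → ∀ {m} → Paired k m →
    outdegAtMostOne (selected f h m) ≡ (outdeg₁ m ℕ.≤ᵇ 1)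
  outdegAtMostOne-selected f h consec {m} p
    rewrite outdeg-centre f h p
          | all-true (λ v → outdeg v (selected f h m) ℕ.≤ᵇ 1)
              (tabulate⁺ {f = suc} (λ v → T⇒≡true (ℕP.≤⇒≤ᵇ (proj₂ (outdeg-leaf f h consec p v)))))
    = ∧-identityʳ _

  data StarEdge : IEdge (suc n′) → Set c where
    fromCentre : ∀ i (w : Fin n′) κ → StarEdge (i , zero , suc w , κ)
    toCentre   : ∀ i (w : Fin n′) κ → StarEdge (i , suc w , zero , κ)

  leafOf : IEdge (suc n′) → V
  leafOf (_ , x , y , _) = if x ==ᶠ zero then y else x

  -- edges are identified by their numbers
  AloneAtLeaf : List (IEdge (suc n′)) → IEdge (suc n′) → Set c
  AloneAtLeaf F e = All (λ e′ → toℕ (leafOf e′) ≡ toℕ (leafOf e) → proj₁ e′ ≡ proj₁ e) F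

  OneEdgePerLeaf : List (IEdge (suc n′)) → Set c
  OneEdgePerLeaf F = All (AloneAtLeaf F) F

  UsedAtLeaf : List ℕ → Fin n′ → List (IEdge (suc n′)) → Set c
  UsedAtLeaf used v F = All (λ e → toℕ (leafOf e) ≡ suc (toℕ v) → elemℕ (proj₁ e) used ≡ true) F

  -- definitionally the local functions next and step of cycleFrom
  module Search (F : List (IEdge (suc n′))) (fuel : ℕ) (s v : V) (used : List ℕ) (visited : List V) where
    next : ℕ → V → Bool
    next idx w = (w ==ᶠ s) ∨ (not (any (w ==ᶠ_) visited) ∧ cycleFrom F fuel s w (idx ∷ used) (w ∷ visited))

    step : IEdge (suc n′) → Bool
    step (idx , x , y , _) =
      not (elemℕ idx used) ∧ ((if x ==ᶠ v then next idx y else false) ∨ (if y ==ᶠ v then next idx x else false))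

  elemℕ-head : ∀ {k k′} used → k ≡ k′ → elemℕ k (k′ ∷ used) ≡ true
  elemℕ-head {k} used ≡.refl rewrite ≡ᵇ-true {k} ≡.refl = ≡.refl

  usedAtLeaf-head : ∀ F e used → AloneAtLeaf F e →
    All (λ e′ → toℕ (leafOf e′) ≡ toℕ (leafOf e) → elemℕ (proj₁ e′) (proj₁ e ∷ used) ≡ true) F
  usedAtLeaf-head F e used = All.map (λ same-index same-leaf → elemℕ-head used (same-index same-leaf))

  leafExhausted : ∀ F fuel s (v : Fin n′) used visited → All StarEdge F → UsedAtLeaf used v F →
    cycleFrom F fuel s (suc v) used visited ≡ false
  leafExhausted F zero       s v used visited edges exhausted = ≡.refl
  leafExhausted F (suc fuel) s v used visited edges exhausted = any-false (go F edges exhausted)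
    where
    open Search F fuel s (suc v) used visited
    go : ∀ G → All StarEdge G → UsedAtLeaf used v G → All (λ e → step e ≡ false) G
    go []      []                     []                   = []
    go (_ ∷ G) (fromCentre i w κ ∷ es) (isUsed ∷ exhausted) = stuck ∷ go G es exhausted
      where
      stuck : step (i , zero , suc w , κ) ≡ false
      stuck with toℕ w ℕ.≡ᵇ toℕ v in eq
      ... | true  rewrite isUsed (≡.cong suc (≡ᵇ-true⁻¹ eq)) = ≡.refl
      ... | false = ∧-zeroʳ _
    go (_ ∷ G) (toCentre i w κ ∷ es)   (isUsed ∷ exhausted) = stuck ∷ go G es exhausted
      where
      stuck : step (i , suc w , zero , κ) ≡ false
      stuck with toℕ w ℕ.≡ᵇ toℕ v in eq
      ... | true  rewrite isUsed (≡.cong suc (≡ᵇ-true⁻¹ eq)) = ≡.refl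
      ... | false = ∧-zeroʳ _

  cannotReturnToLeaf : ∀ F fuel (s : Fin n′) used visited → All StarEdge F → OneEdgePerLeaf F → UsedAtLeaf used s F →
    cycleFrom F fuel (suc s) zero used visited ≡ false
  cannotReturnToLeaf F zero       s used visited edges alone exhausted = ≡.refl
  cannotReturnToLeaf F (suc fuel) s used visited edges alone exhausted = any-false (go F edges alone exhausted)
    where
    open Search F fuel (suc s) zero used visited
    go : ∀ G → All StarEdge G → All (AloneAtLeaf F) G → UsedAtLeaf used s G → All (λ e → step e ≡ false) G
    go []      []                     []             []                   = []
    go (_ ∷ G) (fromCentre i w κ ∷ es) (a ∷ alones) (isUsed ∷ exhausted) = stuck ∷ go G es alones exhausted
      where
      stuck : step (i , zero , suc w , κ) ≡ false
      stuck with elemℕ i used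
      ... | true  = ≡.refl
      ... | false with toℕ w ℕ.≡ᵇ toℕ s in eq
      ...   | true  = ⊥-elim (false≢true (isUsed (≡.cong suc (≡ᵇ-true⁻¹ eq))))
      ...   | false rewrite leafExhausted F fuel (suc s) w (i ∷ used) (suc w ∷ visited) edges (usedAtLeaf-head F (i , zero , suc w , κ) used a)
                          | ∧-zeroʳ (not (any (suc w ==ᶠ_) visited)) = ≡.refl
    go (_ ∷ G) (toCentre i w κ ∷ es)   (a ∷ alones) (isUsed ∷ exhausted) = stuck ∷ go G es alones exhausted
      where
      stuck : step (i , suc w , zero , κ) ≡ false
      stuck with elemℕ i used
      ... | true  = ≡.refl
      ... | false with toℕ w ℕ.≡ᵇ toℕ s in eq
      ...   | true  = ⊥-elim (false≢true (isUsed (≡.cong suc (≡ᵇ-true⁻¹ eq))))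
      ...   | false rewrite leafExhausted F fuel (suc s) w (i ∷ used) (suc w ∷ visited) edges (usedAtLeaf-head F (i , suc w , zero , κ) used a)
                          | ∧-zeroʳ (not (any (suc w ==ᶠ_) visited)) = ≡.refl

  noCycleThroughLeaf : ∀ F fuel (s : Fin n′) → All StarEdge F → OneEdgePerLeaf F →
    cycleFrom F fuel (suc s) (suc s) [] (suc s ∷ []) ≡ false
  noCycleThroughLeaf F zero       s edges alone = ≡.refl
  noCycleThroughLeaf F (suc fuel) s edges alone = any-false (go F edges alone)
    where
    open Search F fuel (suc s) (suc s) [] (suc s ∷ [])
    returnBlocked : ∀ e → AloneAtLeaf F e → toℕ (leafOf e) ≡ suc (toℕ s) →
                    cycleFrom F fuel (suc s) zero (proj₁ e ∷ []) (zero ∷ suc s ∷ []) ≡ false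
    returnBlocked e alone-e e-at-s = cannotReturnToLeaf F fuel s (proj₁ e ∷ []) (zero ∷ suc s ∷ []) edges alone
      (All.map (λ same-index e′-at-s → elemℕ-head [] (same-index (≡.trans e′-at-s (≡.sym e-at-s)))) alone-e)
    go : ∀ G → All StarEdge G → All (AloneAtLeaf F) G → All (λ e → step e ≡ false) G
    go []      []                     []           = []
    go (_ ∷ G) (fromCentre i w κ ∷ es) (a ∷ alones) = stuck ∷ go G es alones
      where
      stuck : step (i , zero , suc w , κ) ≡ false
      stuck with toℕ w ℕ.≡ᵇ toℕ s in eq
      ... | false = ≡.refl
      ... | true  rewrite returnBlocked (i , zero , suc w , κ) a (≡.cong suc (≡ᵇ-true⁻¹ eq)) = ≡.refl
    go (_ ∷ G) (toCentre i w κ ∷ es)   (a ∷ alones) = stuck ∷ go G es alones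
      where
      stuck : step (i , suc w , zero , κ) ≡ false
      stuck with toℕ w ℕ.≡ᵇ toℕ s in eq
      ... | false = ≡.refl
      ... | true  rewrite returnBlocked (i , suc w , zero , κ) a (≡.cong suc (≡ᵇ-true⁻¹ eq)) = ≡.refl

  noCycleThroughCentre : ∀ F fuel → All StarEdge F → OneEdgePerLeaf F → cycleFrom F fuel zero zero [] (zero ∷ []) ≡ false
  noCycleThroughCentre F zero       edges alone = ≡.refl
  noCycleThroughCentre F (suc fuel) edges alone = any-false (go F edges alone)
    where
    open Search F fuel zero zero [] (zero ∷ [])
    go : ∀ G → All StarEdge G → All (AloneAtLeaf F) G → All (λ e → step e ≡ false) G
    go []      []                     []           = []
    go (_ ∷ G) (fromCentre i w κ ∷ es) (a ∷ alones) = stuck ∷ go G es alones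
      where
      stuck : step (i , zero , suc w , κ) ≡ false
      stuck rewrite leafExhausted F fuel zero w (i ∷ []) (suc w ∷ zero ∷ []) edges (usedAtLeaf-head F (i , zero , suc w , κ) [] a) = ≡.refl
    go (_ ∷ G) (toCentre i w κ ∷ es)   (a ∷ alones) = stuck ∷ go G es alones
      where
      stuck : step (i , suc w , zero , κ) ≡ false
      stuck rewrite leafExhausted F fuel zero w (i ∷ []) (suc w ∷ zero ∷ []) edges (usedAtLeaf-head F (i , suc w , zero , κ) [] a) = ≡.refl

  hasUndirectedCycle-oneEdgePerLeaf : ∀ F → All StarEdge F → OneEdgePerLeaf F → hasUndirectedCycle F ≡ false
  hasUndirectedCycle-oneEdgePerLeaf F edges alone rewrite noCycleThroughCentre F (length F) edges alone =
    any-false (tabulate⁺ {f = suc} (λ s → noCycleThroughLeaf F (length F) s edges alone))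

  selected-starEdges : ∀ {k} f (h : Fin k → Fin n′) {m} → Paired k m → All StarEdge (selected f h m)
  selected-starEdges f h []                  = []
  selected-starEdges f h (pair true  true  p) = fromCentre _ _ _ ∷ toCentre _ _ _ ∷ selected-starEdges (shift₂ f) (h ∘ suc) p
  selected-starEdges f h (pair true  false p) = fromCentre _ _ _ ∷ selected-starEdges (shift₂ f) (h ∘ suc) p
  selected-starEdges f h (pair false true  p) = toCentre _ _ _ ∷ selected-starEdges (shift₂ f) (h ∘ suc) p
  selected-starEdges f h (pair false false p) = selected-starEdges (shift₂ f) (h ∘ suc) p

  selected-leavesAbove : ∀ {k} f (h : Fin k → Fin n′) {b} → Consecutive h b → ∀ {m} → Paired k m →
    All (λ e → suc b ≤ toℕ (leafOf e)) (selected f h m)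
  selected-leavesAbove f h consec []                = []
  selected-leavesAbove f h {b} consec (pair a a′ p) = withHead a a′
    where
    IH = All.map (ℕP.≤-trans (ℕP.n≤1+n _)) (selected-leavesAbove (shift₂ f) (h ∘ suc) (consecutive-tail consec) p)
    head : suc b ≤ suc (toℕ (h zero))
    head = s≤s (ℕP.≤-reflexive (≡.sym (consecutive-head consec)))
    withHead : ∀ a a′ → All (λ e → suc b ≤ toℕ (leafOf e)) (selected f h (a ∷ a′ ∷ _))
    withHead true  true  = head ∷ head ∷ IH
    withHead true  false = head ∷ IH
    withHead false true  = head ∷ IH
    withHead false false = IH

  oneEdgePerLeaf-∷ : ∀ e F → All (λ e′ → toℕ (leafOf e′) ≢ toℕ (leafOf e)) F → OneEdgePerLeaf F → OneEdgePerLeaf (e ∷ F)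
  oneEdgePerLeaf-∷ e F elsewhere alone = ((λ _ → ≡.refl) ∷ All.map (λ ≢e ≡e → ⊥-elim (≢e ≡e)) elsewhere) ∷ extend F elsewhere alone
    where
    extend : ∀ G → All (λ e′ → toℕ (leafOf e′) ≢ toℕ (leafOf e)) G → All (AloneAtLeaf F) G → All (AloneAtLeaf (e ∷ F)) G
    extend []      []                []             = []
    extend (_ ∷ G) (≢e ∷ elsewhere′) (a ∷ alones′) = ((λ ≡e → ⊥-elim (≢e (≡.sym ≡e))) ∷ a) ∷ extend G elsewhere′ alones′

  newLeaf-distinct : ∀ {k} f (h : Fin (suc k) → Fin n′) {b} → Consecutive h b → ∀ {m} → Paired k m →
    ∀ e → toℕ (leafOf e) ≡ suc b → All (λ e′ → toℕ (leafOf e′) ≢ toℕ (leafOf e)) (selected (shift₂ f) (h ∘ suc) m)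
  newLeaf-distinct f h consec p e e-at-b =
    All.map (λ above same → ℕP.<-irrefl (≡.sym (≡.trans same e-at-b)) (ℕP.<-≤-trans (ℕP.n<1+n _) above))
            (selected-leavesAbove (shift₂ f) (h ∘ suc) (consecutive-tail consec) p)

  selected-oneEdgePerLeaf : ∀ {k} f (h : Fin k → Fin n′) {b} → Consecutive h b → ∀ {m} → Paired k m →
    noTwoCycles m ≡ true → OneEdgePerLeaf (selected f h m)
  selected-oneEdgePerLeaf f h consec []                   _     = []
  selected-oneEdgePerLeaf f h consec (pair true  true  p) ()
  selected-oneEdgePerLeaf f h consec (pair true  false p) noTwo =
    oneEdgePerLeaf-∷ _ _ (newLeaf-distinct f h consec p (f 0 , zero , suc (h zero) , kin (suc (h zero))) (≡.cong suc (consecutive-head consec)))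
                         (selected-oneEdgePerLeaf (shift₂ f) (h ∘ suc) (consecutive-tail consec) p noTwo)
  selected-oneEdgePerLeaf f h consec (pair false true  p) noTwo =
    oneEdgePerLeaf-∷ _ _ (newLeaf-distinct f h consec p (f 1 , suc (h zero) , zero , kout (suc (h zero))) (≡.cong suc (consecutive-head consec)))
                         (selected-oneEdgePerLeaf (shift₂ f) (h ∘ suc) (consecutive-tail consec) p noTwo)
  selected-oneEdgePerLeaf f h consec (pair false false p) noTwo =
    selected-oneEdgePerLeaf (shift₂ f) (h ∘ suc) (consecutive-tail consec) p noTwo

  record TwoCycle (F : List (IEdge (suc n′))) : Set c where
    field
      i₁ i₂      : ℕ
      leaf       : Fin n′
      κ₁ κ₂      : Carrier
      i₁≢i₂      : i₁ ≢ i₂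
      out∈       : (i₁ , zero , suc leaf , κ₁) ∈ F
      back∈      : (i₂ , suc leaf , zero , κ₂) ∈ F
      2≤length   : 2 ≤ length F

  twoCycle-∷ : ∀ e F → TwoCycle F → TwoCycle (e ∷ F)
  twoCycle-∷ e F cycle = record
    { i₁ = i₁ ; i₂ = i₂ ; leaf = leaf ; κ₁ = κ₁ ; κ₂ = κ₂ ; i₁≢i₂ = i₁≢i₂
    ; out∈ = there out∈ ; back∈ = there back∈ ; 2≤length = ℕP.m≤n⇒m≤1+n 2≤length }
    where open TwoCycle cycle

  selected-twoCycle : ∀ {k} f (h : Fin k → Fin n′) → Injective _≡_ _≡_ f → ∀ {m} → Paired k m →
    noTwoCycles m ≡ false → TwoCycle (selected f h m)
  selected-twoCycle f h f-inj []                   ()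
  selected-twoCycle f h f-inj (pair true  true  p) _ = record
    { i₁ = f 0 ; i₂ = f 1 ; leaf = h zero ; κ₁ = _ ; κ₂ = _ ; i₁≢i₂ = λ eq → ℕP.0≢1+n (f-inj eq)
    ; out∈ = here ≡.refl ; back∈ = there (here ≡.refl) ; 2≤length = s≤s (s≤s z≤n) }
  selected-twoCycle f h f-inj (pair true  false p) two = twoCycle-∷ _ _ (selected-twoCycle (shift₂ f) (h ∘ suc) (shift₂-injective f-inj) p two)
  selected-twoCycle f h f-inj (pair false true  p) two = twoCycle-∷ _ _ (selected-twoCycle (shift₂ f) (h ∘ suc) (shift₂-injective f-inj) p two)
  selected-twoCycle f h f-inj (pair false false p) two = selected-twoCycle (shift₂ f) (h ∘ suc) (shift₂-injective f-inj) p two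

  any-true : ∀ {a} {A : Set a} {p : A → Bool} {x xs} → x ∈ xs → p x ≡ true → any p xs ≡ true
  any-true (here ≡.refl) px≡true rewrite px≡true = ≡.refl
  any-true {p = p} {xs = y ∷ _} (there x∈xs) px≡true rewrite any-true {p = p} x∈xs px≡true = ∨-zeroʳ (p y)

  -- out along i₁ to the leaf, back along i₂ to the centre
  twoCycle-found : ∀ F → TwoCycle F → ∀ fuel → 2 ≤ fuel → cycleFrom F fuel zero zero [] (zero ∷ []) ≡ true
  twoCycle-found F cycle (suc zero)       (s≤s ())
  twoCycle-found F cycle (suc (suc fuel)) _ = any-true out∈ out
    where
    open TwoCycle cycle
    module Back = Search F fuel zero (suc leaf) (i₁ ∷ []) (suc leaf ∷ zero ∷ [])
    back : Back.step (i₂ , suc leaf , zero , κ₂) ≡ true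
    back rewrite ≡ᵇ-false (i₁≢i₂ ∘ ≡.sym) | ≡ᵇ-true {toℕ leaf} ≡.refl = ≡.refl
    returns : cycleFrom F (suc fuel) zero (suc leaf) (i₁ ∷ []) (suc leaf ∷ zero ∷ []) ≡ true
    returns = any-true back∈ back
    out : Search.step F (suc fuel) zero zero [] (zero ∷ []) (i₁ , zero , suc leaf , κ₁) ≡ true
    out rewrite returns = ≡.refl

  hasUndirectedCycle-twoCycle : ∀ F → TwoCycle F → hasUndirectedCycle F ≡ true
  hasUndirectedCycle-twoCycle F cycle rewrite twoCycle-found F cycle (length F) (TwoCycle.2≤length cycle) = ≡.refl

  hasUndirectedCycle-selected : ∀ {k} f (h : Fin k → Fin n′) {b} → Consecutive h b → Injective _≡_ _≡_ f →
    ∀ {m} → Paired k m → hasUndirectedCycle (selected f h m) ≡ not (noTwoCycles m)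
  hasUndirectedCycle-selected f h consec f-inj {m} p with noTwoCycles m in eq
  ... | true  = hasUndirectedCycle-oneEdgePerLeaf (selected f h m) (selected-starEdges f h p) (selected-oneEdgePerLeaf f h consec p eq)
  ... | false = hasUndirectedCycle-twoCycle (selected f h m) (selected-twoCycle f h f-inj p eq)

  isSpanningIncomingForest-selected : ∀ {k} f (h : Fin k → Fin n′) {b} → Consecutive h b → Injective _≡_ _≡_ f →
    ∀ {m} → Paired k m → isSpanningIncomingForest (selected f h m) ≡ (outdeg₁ m ℕ.≤ᵇ 1) ∧ noTwoCycles m
  isSpanningIncomingForest-selected f h consec f-inj {m} p
    rewrite outdegAtMostOne-selected f h consec p | hasUndirectedCycle-selected f h consec f-inj p | not-involutive (noTwoCycles m)
    = ≡.refl

  forestSum-star : ∀ {k} (h : Fin k → Fin n′) {b} → Consecutive h b → ∀ i →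
    forestSum (star h) i ≈ esym i (tabulate (outLabels h)) + inflowTerm k (outLabels h) (inLabels h) i
  forestSum-star {k} h consec i = begin
    forestSum (star h) i
      ≡⟨ ≡.cong (λ l → sumL (map term (masks l))) (length-star h) ⟩
    sumL (map term (masks (double k)))
      ≈⟨ sumL-map-congᴬ (masks-paired k) termIsForestTerm ⟩
    sumL (map (forestTerm (outLabels h) (inLabels h) i) (masks (double k)))
      ≈⟨ sum-forestTerm k (outLabels h) (inLabels h) i ⟩
    esym i (tabulate (outLabels h)) + inflowTerm k (outLabels h) (inLabels h) i ∎
    where
    term : List Bool → Carrier
    term m = if isSpanningIncomingForest (selected id h m) ∧ (length (selected id h m) ℕ.≡ᵇ i)
             then edgeProduct (selected id h m) else 0#
    termIsForestTerm : ∀ {m} → Paired k m → term m ≈ forestTerm (outLabels h) (inLabels h) i m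
    termIsForestTerm p rewrite isSpanningIncomingForest-selected id h consec id p
                             | length-selected id h p | edgeProduct-selected id h p = refl


module Mammillary {c ℓ} (R : CommutativeRing c ℓ) (t : ℕ) (p : 3 ≤ suc (suc (suc t)))
                  (kin kout : Fin (suc (suc (suc t))) → CommutativeRing.Carrier R) where
  open CommutativeRing R hiding (zero)
  open Over R
  open RingFacts R
  open FiniteFamilies R
  open Determinants R using (det-cong)
  open Vandermonde R using (esymMatrix; vandermonde; det-esymMatrix; pairsProduct; pairsProduct-consecutive)
  open ForestSums R using (inflowTerm)
  open CharacteristicPolynomial R using (module Star)
  open Star (suc t) kin kout using (kin′; kout′; esymWithout; coeff-charPoly)
  open StarGraph R (suc (suc t)) kin kout using (spoke; forestSum-star)
  open import Relation.Binary.Reasoning.Setoid setoid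
  open import Algebra.Solver.Ring.NaturalCoefficients.Default commutativeSemiring

  n : ℕ
  n = suc (suc (suc t))

  -- compartment J + 3
  leaf : Fin (suc t) → Fin n
  leaf J = suc (suc J)

  outRate inRate : Fin (suc t) → Carrier
  outRate J = kout (leaf J)
  inRate J = kin (leaf J)

  k21 k12 : Carrier
  k21 = kin (vertex₂ p)
  k12 = kout (vertex₂ p)

  Σ′ : List Carrier
  Σ′ = tabulate outRate

  g : ℕ → Carrier
  g = gCoeff p kin kout

  cc : ℕ → Carrier
  cc = cCoeff kin kout

  outer-leaves : outer n ≡ tabulate leaf
  outer-leaves = filterᵇ-tabulate-all (λ i → 2 ℕ.≤ᵇ toℕ i) leaf (λ i → ≡.refl)

  Sigma-leaves : Sigma kout ≡ Σ′
  Sigma-leaves = ≡.trans (≡.cong (map kout) outer-leaves) (map-tabulate leaf kout)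

  SigmaWithout-leaves : ∀ J → SigmaWithout kout (leaf J) ≡ tabulate (outRate ∘ punchIn J)
  SigmaWithout-leaves J =
    ≡.trans (≡.cong (λ L → map kout (filterᵇ (λ i → not (i ==ᶠ leaf J)) L)) outer-leaves)
            (≡.trans (≡.cong (map kout) (filterᵇ-tabulate-punchIn leaf (λ i → ≡.refl) J)) (map-tabulate (leaf ∘ punchIn J) kout))

  g-forests : ∀ i → g i ≈ esym i Σ′ + inflowTerm (suc t) outRate inRate i
  g-forests i = trans (reflexive (≡.cong (λ L → forestSum (concatMap spoke L) i) outer-leaves)) (forestSum-star suc (λ i → ≡.refl) i)

  g-zero : g 0 ≈ 1#
  g-zero = trans (g-forests 0) (+-identityʳ 1#)

  g-last : g (n ∸ 1) ≈ 0#
  g-last = trans (g-forests (suc (suc t)))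
                 (+-vanish (esym-tabulate-beyond (suc t) outRate (suc (suc t)) (ℕP.n<1+n _))
                           (sumL-tabulate-zero (suc t) (λ J → *-vanishˡ {inRate J} (esym-tabulate-beyond t (outRate ∘ punchIn J) (suc t) (ℕP.n<1+n t)))))

  g-middle : ∀ r → 1 ≤ r → r ≤ n ∸ 2 → g r ≈ esym r (Sigma kout) + sumL (map (λ l → Mentry kout r l * kin l) (outer n))
  g-middle (suc r) _ _ = trans (g-forests (suc r)) (+-cong (reflexive (≡.cong (esym (suc r)) (≡.sym Sigma-leaves))) (reflexive (≡.sym M-leaves)))
    where
    M-leaves : sumL (map (λ l → Mentry kout (suc r) l * kin l) (outer n)) ≡ sumL (tabulate (λ J → esym r (tabulate (outRate ∘ punchIn J)) * inRate J))
    M-leaves = ≡.trans (≡.cong (λ L → sumL (map (λ l → Mentry kout (suc r) l * kin l) L)) outer-leaves)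
                       (≡.trans (≡.cong sumL (map-tabulate leaf (λ l → Mentry kout (suc r) l * kin l)))
                                (≡.cong sumL (tabulate-cong (λ J → ≡.cong (λ L → esym r L * inRate J) (SigmaWithout-leaves J)))))

  coefficient-split : ∀ r →
    esym (suc r) (tabulate kout′) + sumL (tabulate (λ J → kin′ J * esymWithout r J))
      ≈ k21 * esym r Σ′ + k12 * (esym r Σ′ + inflowTerm (suc t) outRate inRate r) + (esym (suc r) Σ′ + inflowTerm (suc t) outRate inRate (suc r))
  coefficient-split zero = begin
    (k12 * 1# + e₁) + (k21 * 1# + S)
      ≈⟨ solve 4 (λ a e b s → (a :* con 1 :+ e) :+ (b :* con 1 :+ s) := b :* con 1 :+ a :* con 1 :+ (e :+ s)) refl k12 e₁ k21 S ⟩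
    k21 * 1# + k12 * 1# + (e₁ + S)
      ≈⟨ +-cong (+-congˡ (*-congˡ (sym (+-identityʳ 1#)))) (+-congˡ (sumL-tabulate-cong (suc t) (λ J → *-comm (inRate J) 1#))) ⟩
    k21 * 1# + k12 * (1# + 0#) + (e₁ + sumL (tabulate (λ J → 1# * inRate J))) ∎
    where
    e₁ = esym 1 Σ′
    S = sumL (tabulate (λ J → inRate J * 1#))
  coefficient-split (suc r) = begin
    (k12 * e + e′) + (k21 * e + sumL (tabulate (λ J → inRate J * (k12 * A J + B J))))
      ≈⟨ +-congˡ (+-congˡ (trans (sumL-tabulate-cong (suc t) (λ J →
                                     solve 4 (λ y k a b → y :* (k :* a :+ b) := k :* (a :* y) :+ b :* y) refl (inRate J) k12 (A J) (B J)))
                                 (trans (sumL-tabulate-distrib-+ (suc t) (λ J → k12 * (A J * inRate J)) (λ J → B J * inRate J))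
                                        (+-congʳ (sym (*-distribˡ-sumL-tabulate (suc t) k12 (λ J → A J * inRate J))))))) ⟩
    (k12 * e + e′) + (k21 * e + (k12 * SA + SB))
      ≈⟨ solve 6 (λ k e e′ b sa sb → (k :* e :+ e′) :+ (b :* e :+ (k :* sa :+ sb)) := b :* e :+ k :* (e :+ sa) :+ (e′ :+ sb))
                 refl k12 e e′ k21 SA SB ⟩
    k21 * e + k12 * (e + SA) + (e′ + SB) ∎
    where
    e = esym (suc r) Σ′
    e′ = esym (suc (suc r)) Σ′
    A = λ J → esym r (tabulate (outRate ∘ punchIn J))
    B = λ J → esym (suc r) (tabulate (outRate ∘ punchIn J))
    SA = sumL (tabulate (λ J → A J * inRate J))
    SB = sumL (tabulate (λ J → B J * inRate J))

  cc-zero : cc 0 ≈ 0#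
  cc-zero = trans (coeff-charPoly 0 (suc (suc t)) ≡.refl)
                  (+-vanish (esym-tabulate-beyond (suc (suc t)) kout′ (suc (suc (suc t))) (ℕP.n<1+n _))
                            (sumL-tabulate-zero (suc (suc t)) (λ J → *-vanishʳ {kin′ J} (esym-tabulate-beyond (suc t) (kout′ ∘ punchIn J) (suc (suc t)) (ℕP.n<1+n _)))))

  cc-recurrence : ∀ r → r ≤ suc t → cc (suc (suc t) ∸ r) ≈ k21 * esym r Σ′ + k12 * g r + g (suc r)
  cc-recurrence r r≤t+1 = begin
    cc (suc (suc t) ∸ r)
      ≈⟨ coeff-charPoly (suc (suc t) ∸ r) r (≡.trans (ℕP.+-suc _ r) (≡.cong suc (ℕP.m∸n+n≡m (ℕP.m≤n⇒m≤1+n r≤t+1)))) ⟩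
    esym (suc r) (tabulate kout′) + sumL (tabulate (λ J → kin′ J * esymWithout r J))
      ≈⟨ coefficient-split r ⟩
    k21 * esym r Σ′ + k12 * (esym r Σ′ + inflowTerm (suc t) outRate inRate r) + (esym (suc r) Σ′ + inflowTerm (suc t) outRate inRate (suc r))
      ≈⟨ +-cong (+-congˡ (*-congˡ (sym (g-forests r)))) (sym (g-forests (suc r))) ⟩
    k21 * esym r Σ′ + k12 * g r + g (suc r) ∎

  cc-formula : ∀ m → 1 ≤ m → m ≤ n ∸ 1 → cc (n ∸ m) ≈ k21 * esym (m ∸ 1) (Sigma kout) + k12 * g (m ∸ 1) + g m
  cc-formula (suc r) _ (s≤s r≤t+1) rewrite Sigma-leaves = cc-recurrence r r≤t+1

  alternating-sum : sumFromTo 1 (n ∸ 1) (λ m → pow (- 1#) (m ∸ 1) * pow k12 (n ∸ 1 ∸ m) * cc (n ∸ m))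
    ≈ sumFromTo 0 (n ∸ 2) (λ m → pow (- 1#) m * pow k12 (n ∸ 2 ∸ m) * esym m (Sigma kout)) * k21 + pow k12 (n ∸ 1)
  alternating-sum = begin
    sumL (applyUpTo (λ i → pow (- 1#) i * pow k12 (suc t ∸ i) * cc (suc (suc t) ∸ i)) (suc (suc t)))
      ≡⟨ ≡.cong sumL (applyUpTo-tabulate (λ i → pow (- 1#) i * pow k12 (suc t ∸ i) * cc (suc (suc t) ∸ i)) (suc (suc t))) ⟩
    sumL (tabulate (λ (i : Fin (suc (suc t))) → pow (- 1#) (toℕ i) * pow k12 (suc t ∸ toℕ i) * cc (suc (suc t) ∸ toℕ i)))
      ≈⟨ sumL-tabulate-cong (suc (suc t)) (λ i → trans (*-congˡ (cc-recurrence (toℕ i) (ℕP.≤-pred (FinP.toℕ<n i)))) (term (toℕ i))) ⟩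
    sumL (tabulate (λ (i : Fin (suc (suc t))) → k21 * X (toℕ i) + telescoping (toℕ i)))
      ≈⟨ sumL-tabulate-distrib-+ (suc (suc t)) (λ i → k21 * X (toℕ i)) (λ i → telescoping (toℕ i)) ⟩
    sumL (tabulate (λ (i : Fin (suc (suc t))) → k21 * X (toℕ i))) + sumL (tabulate (λ (i : Fin (suc (suc t))) → telescoping (toℕ i)))
      ≈⟨ +-cong (trans (sym (*-distribˡ-sumL-tabulate (suc (suc t)) k21 (X ∘ toℕ))) (*-comm _ _)) (alternating-telescope (suc t) k12 g) ⟩
    sumL (tabulate {n = suc (suc t)} (X ∘ toℕ)) * k21 + (pow k12 (suc (suc t)) * g 0 - pow (- 1#) (suc (suc t)) * g (suc (suc t)))
      ≈⟨ +-congˡ (trans (+-vanishʳ (-‿vanish (*-vanishʳ g-last))) (trans (*-congˡ g-zero) (*-identityʳ _))) ⟩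
    sumL (tabulate {n = suc (suc t)} (X ∘ toℕ)) * k21 + pow k12 (suc (suc t))
      ≡⟨ ≡.cong (λ L → sumL L * k21 + pow k12 (suc (suc t))) (≡.sym (applyUpTo-tabulate X (suc (suc t)))) ⟩
    sumL (applyUpTo X (suc (suc t))) * k21 + pow k12 (suc (suc t))
      ≡⟨ ≡.cong (λ Σ → sumL (applyUpTo (λ i → pow (- 1#) i * pow k12 (suc t ∸ i) * esym i Σ) (suc (suc t))) * k21 + pow k12 (suc (suc t)))
                (≡.sym Sigma-leaves) ⟩
    sumFromTo 0 (n ∸ 2) (λ m → pow (- 1#) m * pow k12 (n ∸ 2 ∸ m) * esym m (Sigma kout)) * k21 + pow k12 (n ∸ 1) ∎
    where
    X : ℕ → Carrier
    X i = pow (- 1#) i * pow k12 (suc t ∸ i) * esym i Σ′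
    telescoping : ℕ → Carrier
    telescoping i = pow (- 1#) i * (pow k12 (suc t ∸ i) * (k12 * g i + g (suc i)))
    term : ∀ i → pow (- 1#) i * pow k12 (suc t ∸ i) * (k21 * esym i Σ′ + k12 * g i + g (suc i)) ≈ k21 * X i + telescoping i
    term i = solve 7 (λ s Q b e k gi gi₁ → s :* Q :* (b :* e :+ k :* gi :+ gi₁) := b :* (s :* Q :* e) :+ s :* (Q :* (k :* gi :+ gi₁)))
                     refl (pow (- 1#) i) (pow k12 (suc t ∸ i)) k21 (esym i Σ′) k12 (g i) (g (suc i))

  det-M : detR (n ∸ 2) (Mmatrix kout) ≈ vandermondeProd kout
  det-M = begin
    detR (suc t) (Mmatrix kout)
      ≈⟨ det-cong (suc t) (λ r c → reflexive (≡.cong (esym (toℕ r)) (SigmaWithout-leaves c))) ⟩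
    detR (suc t) (esymMatrix outRate)
      ≈⟨ det-esymMatrix t outRate ⟩
    vandermonde (suc t) outRate
      ≈⟨ pairsProduct-consecutive kout leaf (λ i → ≡.refl) ⟨
    pairsProduct kout (tabulate leaf) (tabulate leaf)
      ≡⟨ ≡.cong (λ L → pairsProduct kout L L) (≡.sym outer-leaves) ⟩
    vandermondeProd kout ∎

proposition3p6 : ∀ {c ℓ : Level} (R : CommutativeRing c ℓ) →
  let open CommutativeRing R
      open Over R
  in (n : ℕ) (p : 3 ≤ n) (kin kout : Fin n → Carrier) →
  let k21 = kin (vertex₂ p)
      k12 = kout (vertex₂ p)
      Σ = Sigma kout
      cc = cCoeff kin kout
      g = gCoeff p kin kout
  in
  -- (a)
  (cc 0 ≈ 0# ×
   (∀ (m : ℕ) → 1 ≤ m → m ≤ n ∸ 1 →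
      cc (n ∸ m) ≈ k21 * esym (m ∸ 1) Σ + k12 * g (m ∸ 1) + g m))
  ×
  -- (b)
  (sumFromTo 1 (n ∸ 1) (λ m → pow (- 1#) (m ∸ 1) * pow k12 (n ∸ 1 ∸ m) * cc (n ∸ m))
     ≈ sumFromTo 0 (n ∸ 2) (λ m → pow (- 1#) m * pow k12 (n ∸ 2 ∸ m) * esym m Σ) * k21
       + pow k12 (n ∸ 1))
  ×
  -- (c)
  (g 0 ≈ 1# × g (n ∸ 1) ≈ 0# ×
   (∀ (r : ℕ) → 1 ≤ r → r ≤ n ∸ 2 →
      g r ≈ esym r Σ + sumL (map (λ l → Mentry kout r l * kin l) (outer n))))
  ×
  -- (d)
  (detR (n ∸ 2) (Mmatrix kout) ≈ vandermondeProd kout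
     ⊎ detR (n ∸ 2) (Mmatrix kout) ≈ - vandermondeProd kout)
proposition3p6 R (suc (suc (suc t))) p@(s≤s (s≤s (s≤s _))) kin kout =
  (cc-zero , cc-formula) , alternating-sum , (g-zero , g-last , g-middle) , inj₁ det-M
  where open Mammillary R t p kin kout
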